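{- Let $\mathcal{C}$ be a stiff symmetric monoidal category. There is a bijective correspondence between localisable monads on $\mathcal{C}$ and formal monads on $\overline{\mathcal{C}}$ in the 2-category $[\mathrm{ZI}(\mathcal{C})^{\mathrm{op}},\mathbf{Cat}]$. In one direction, a localisable monad $(T,\eta,\mu,\mathrm{st})$ is sent to the formal monad whose components are the monads $(T|_u,\eta|_u,\mu|_u)$ on $\mathcal{C}|_u$; in the other direction, a formal monad $(T_u,\eta_u,\mu_u)_{u}$ is sent to the monad $T_1$ on $\mathcal{C}|_1\cong\mathcal{C}$ equipped with the strength $\mathrm{st}_{A,U}=\varepsilon_{T_1 F G A}\circ F T_u \eta_{GA}\colon T_1(A)\otimes U=FGT_1A=FT_uGA\to FGT_1FGA\to T_1FGA=T_1(A\otimes U)$, where $F=\mathcal{C}\|_{u\leq 1}$, $G=\mathcal{C}|_{u\leq 1}$ and $\eta,\varepsilon$ are the unit and counit of $F\dashv G$.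
   Context: Let $\mathcal{C}$ be a symmetric monoidal category with unit $I$, unitors $\lambda,\rho$, associator $\alpha$ and symmetry $\sigma$ (coherence isomorphisms are often suppressed). A central idempotent is a morphism $u\colon U\to I$ such that $\rho_U\circ(U\otimes u)=\lambda_U\circ(u\otimes U)\colon U\otimes U\to U$ and this morphism is invertible; $u$ and $v\colon V\to I$ are identified when $u=v\circ m$ for an isomorphism $m$. $\mathrm{ZI}(\mathcal{C})$ is the meet-semilattice of central idempotents, with $u\leq v$ iff $u=v\circ m$ for some morphism $m\colon U\to V$, meet $u\otimes v$ and top $1=\mathrm{id}_I$, regarded as a poset category. For a central idempotent $u$, $\mathcal{C}|_u$ is the symmetric monoidal category with the objects of $\mathcal{C}$, morphisms $A\to B$ being morphisms $A\otimes U\to B$ of $\mathcal{C}$, composition of $f\colon A\otimes U\to B$ and $g\colon B\otimes U\to C$ given by $g\circ(f\otimes U)\circ(A\otimes U\otimes u)^{ -1}$, identity $A\otimes u$, tensor of objects as in $\mathcal{C}$, and tensor of $f\colon A\otimes U\to B$, $f'\colon A'\otimes U\to B'$ given by $(f\otimes f')\circ(A\otimes\sigma_{A',U}\otimes U)\circ(A\otimes A'\otimes U\otimes u)^{ -1}$. For $u\leq v$ with $u=v\circ m$, the functor $\mathcal{C}|_{u\leq v}\colon\mathcal{C}|_v\to\mathcal{C}|_u$ is $A\mapsto A$, $f\mapsto f\circ(A\otimes m)$, and $\mathcal{C}\|_{u\leq v}\colon\mathcal{C}|_u\to\mathcal{C}|_v$ is $A\mapsto A\otimes U$, $f\mapsto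 (f\otimes U)\circ(A\otimes u\otimes U)^{ -1}\circ(A\otimes U\otimes v)$; one has $\mathcal{C}\|_{u\leq v}\dashv\mathcal{C}|_{u\leq v}$. $\mathcal{C}$ is stiff when for every object $A$ and central idempotents $u,v$ the square with vertices $A\otimes U\otimes V$, $A\otimes V$, $A\otimes U$, $A$ and edges induced by $u,v$ (bottom $A\otimes u$, right $A\otimes v$) is a pullback. A monad $(T,\eta,\mu)$ on $\mathcal{C}$ is localisable when there are morphisms $\mathrm{st}_{A,U}\colon T(A)\otimes U\to T(A\otimes U)$ for each object $A$ and central idempotent $u\colon U\to I$ with: $T(\rho_A)\circ\mathrm{st}_{A,I}=\rho_{T(A)}$; $T(\alpha_{A,U,V})\circ\mathrm{st}_{A,U\otimes V}=\mathrm{st}_{A\otimes U,V}\circ(\mathrm{st}_{A,U}\otimes V)\circ\alpha_{TA,U,V}$; $\eta_{A\otimes U}=\mathrm{st}_{A,U}\circ(\eta_A\otimes U)$; $\mu_{A\otimes U}\circ T(\mathrm{st}_{A,U})\circ\mathrm{st}_{T(A),U}=\mathrm{st}_{A,U}\circ(\mu_A\otimes U)$; $\mathrm{st}_{A,V}\circ(T(A)\otimes m)=T(A\otimes m)\circ\mathrm{st}_{A,U}$ whenever $u=v\circ m$; and $\mathrm{st}_{B,U}\circ(T(f)\otimes U)=T(f\otimes U)\circ\mathrm{st}_{A,U}$ for all $f\colon A\to B$. For such $T$ and central idempotent $u$, $T|_u$ is the monad on $\mathcal{C}|_u$ with $T|_u(A)=T(A)$, $T|_u(f\colon A\otimes U\to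 B)=T(f)\circ\mathrm{st}_{A,U}$, $(\eta|_u)_A=\eta_A\otimes u$, $(\mu|_u)_A=\mu_A\otimes u$. $\overline{\mathcal{C}}\colon\mathrm{ZI}(\mathcal{C})^{\mathrm{op}}\to\mathbf{Cat}$ sends $u$ to $\mathcal{C}|_u$ and $u\leq v$ to $\mathcal{C}|_{u\leq v}$. The 2-category $[\mathrm{ZI}(\mathcal{C})^{\mathrm{op}},\mathbf{Cat}]$ has functors as 0-cells, natural transformations as 1-cells and modifications as 2-cells. A formal monad on $\overline{\mathcal{C}}$ amounts to: a monad $(T_u,\eta_u,\mu_u)$ on $\mathcal{C}|_u$ for every central idempotent $u$, such that for all $u\leq v$: $T_u\circ\mathcal{C}|_{u\leq v}=\mathcal{C}|_{u\leq v}\circ T_v$ as functors (in particular $T_u(A)=T_v(A)$), $(\eta_u)_{\mathcal{C}|_{u\leq v}A}=\mathcal{C}|_{u\leq v}((\eta_v)_A)$ and $(\mu_u)_{\mathcal{C}|_{u\leq v}A}=\mathcal{C}|_{u\leq v}((\mu_v)_A)$. -}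

module Defs where

open import Level using (Level; _⊔_) renaming (suc to lsuc)
open import Data.Product using (Σ; _×_; _,_)
open import Relation.Binary.Structures using (IsEquivalence)

-- Symmetric monoidal categories (hom-setoids), with all the standard
-- axioms.  Convention: α⇒ : A ⊗ (B ⊗ C) ⇒ (A ⊗ B) ⊗ C, which is the
-- direction of α used in the paper's strength axiom.

record SMC (o ℓ e : Level) : Set (lsuc (o ⊔ ℓ ⊔ e)) where
  infixr 9 _∘_
  infixr 10 _⊗₀_ _⊗₁_
  infix 4 _≈_
  field
    Obj  : Set o
    _⇒_  : Obj → Obj → Set ℓ
    _≈_  : ∀ {A B} → A ⇒ B → A ⇒ B → Set e
    ≈-equiv : ∀ {A B} → IsEquivalence (_≈_ {A} {B})
    id   : ∀ {A} → A ⇒ A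
    _∘_  : ∀ {A B C} → B ⇒ C → A ⇒ B → A ⇒ C
    identityˡ : ∀ {A B} {f : A ⇒ B} → id ∘ f ≈ f
    identityʳ : ∀ {A B} {f : A ⇒ B} → f ∘ id ≈ f
    assoc : ∀ {A B C D} {f : A ⇒ B} {g : B ⇒ C} {h : C ⇒ D} →
            (h ∘ g) ∘ f ≈ h ∘ (g ∘ f)
    ∘-resp-≈ : ∀ {A B C} {f f' : B ⇒ C} {g g' : A ⇒ B} →
               f ≈ f' → g ≈ g' → f ∘ g ≈ f' ∘ g'
    _⊗₀_ : Obj → Obj → Obj
    _⊗₁_ : ∀ {A B C D} → A ⇒ B → C ⇒ D → (A ⊗₀ C) ⇒ (B ⊗₀ D)
    ⊗-id : ∀ {A B} → id {A} ⊗₁ id {B} ≈ id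
    ⊗-∘  : ∀ {A B C A' B' C'} {f : B ⇒ C} {g : A ⇒ B} {f' : B' ⇒ C'} {g' : A' ⇒ B'} →
           (f ∘ g) ⊗₁ (f' ∘ g') ≈ (f ⊗₁ f') ∘ (g ⊗₁ g')
    ⊗-resp-≈ : ∀ {A B C D} {f f' : A ⇒ B} {g g' : C ⇒ D} →
               f ≈ f' → g ≈ g' → f ⊗₁ g ≈ f' ⊗₁ g'
    I : Obj
    λ⇒ : ∀ {A} → (I ⊗₀ A) ⇒ A
    λ⇐ : ∀ {A} → A ⇒ (I ⊗₀ A)
    λ-isoˡ : ∀ {A} → λ⇐ {A} ∘ λ⇒ ≈ id
    λ-isoʳ : ∀ {A} → λ⇒ {A} ∘ λ⇐ ≈ id
    λ-natural : ∀ {A B} {f : A ⇒ B} → f ∘ λ⇒ ≈ λ⇒ ∘ (id ⊗₁ f)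
    ρ⇒ : ∀ {A} → (A ⊗₀ I) ⇒ A
    ρ⇐ : ∀ {A} → A ⇒ (A ⊗₀ I)
    ρ-isoˡ : ∀ {A} → ρ⇐ {A} ∘ ρ⇒ ≈ id
    ρ-isoʳ : ∀ {A} → ρ⇒ {A} ∘ ρ⇐ ≈ id
    ρ-natural : ∀ {A B} {f : A ⇒ B} → f ∘ ρ⇒ ≈ ρ⇒ ∘ (f ⊗₁ id)
    α⇒ : ∀ {A B C} → (A ⊗₀ (B ⊗₀ C)) ⇒ ((A ⊗₀ B) ⊗₀ C)
    α⇐ : ∀ {A B C} → ((A ⊗₀ B) ⊗₀ C) ⇒ (A ⊗₀ (B ⊗₀ C))
    α-isoˡ : ∀ {A B C} → α⇐ {A} {B} {C} ∘ α⇒ ≈ id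
    α-isoʳ : ∀ {A B C} → α⇒ {A} {B} {C} ∘ α⇐ ≈ id
    α-natural : ∀ {A B C A' B' C'} {f : A ⇒ A'} {g : B ⇒ B'} {h : C ⇒ C'} →
                α⇒ ∘ (f ⊗₁ (g ⊗₁ h)) ≈ ((f ⊗₁ g) ⊗₁ h) ∘ α⇒
    σ : ∀ {A B} → (A ⊗₀ B) ⇒ (B ⊗₀ A)
    σ-natural : ∀ {A B C D} {f : A ⇒ B} {g : C ⇒ D} →
                σ ∘ (f ⊗₁ g) ≈ (g ⊗₁ f) ∘ σ
    σ-involutive : ∀ {A B} → σ {B} {A} ∘ σ {A} {B} ≈ id
    triangle : ∀ {A B} → (id {A} ⊗₁ λ⇒ {B}) ∘ α⇐ ≈ ρ⇒ ⊗₁ id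
    pentagon : ∀ {A B C D} →
               (id {A} ⊗₁ α⇐ {B} {C} {D}) ∘ α⇐ ∘ (α⇐ ⊗₁ id) ≈ α⇐ ∘ α⇐
    hexagon : ∀ {A B C} →
              α⇐ {B} {C} {A} ∘ σ {A} {B ⊗₀ C} ∘ α⇐ {A} {B} {C}
                ≈ (id ⊗₁ σ) ∘ α⇐ ∘ (σ ⊗₁ id)

-- "Categories" given only by their operations (used to state what a
-- monad on C and on C|_u is; C|_u is given by the paper's formulas).

record CatOps {o} (Obj : Set o) (ℓ e : Level) : Set (o ⊔ lsuc (ℓ ⊔ e)) where
  field
    Hom  : Obj → Obj → Set ℓ
    Eq   : ∀ {A B} → Hom A B → Hom A B → Set e
    idt  : ∀ A → Hom A A
    comp : ∀ {A B C} → Hom B C → Hom A B → Hom A C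

record MonadData {o ℓ e} {Obj : Set o} (K : CatOps Obj ℓ e) (T₀ : Obj → Obj)
       : Set (o ⊔ ℓ) where
  open CatOps K
  field
    map : ∀ {A B} → Hom A B → Hom (T₀ A) (T₀ B)
    η   : ∀ A → Hom A (T₀ A)
    μ   : ∀ A → Hom (T₀ (T₀ A)) (T₀ A)

record IsMonad {o ℓ e} {Obj : Set o} (K : CatOps Obj ℓ e) (T₀ : Obj → Obj)
       (M : MonadData K T₀) : Set (o ⊔ ℓ ⊔ e) where
  open CatOps K
  open MonadData M
  field
    map-resp : ∀ {A B} {f g : Hom A B} → Eq f g → Eq (map f) (map g)
    map-id   : ∀ {A} → Eq (map (idt A)) (idt (T₀ A))
    map-comp : ∀ {A B C} (g : Hom B C) (f : Hom A B) →
               Eq (map (comp g f)) (comp (map g) (map f))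
    η-natural : ∀ {A B} (f : Hom A B) → Eq (comp (η B) f) (comp (map f) (η A))
    μ-natural : ∀ {A B} (f : Hom A B) →
                Eq (comp (μ B) (map (map f))) (comp (map f) (μ A))
    μ-assoc  : ∀ A → Eq (comp (μ A) (map (μ A))) (comp (μ A) (μ (T₀ A)))
    μ-unitˡ  : ∀ A → Eq (comp (μ A) (η (T₀ A))) (idt (T₀ A))
    μ-unitʳ  : ∀ A → Eq (comp (μ A) (map (η A))) (idt (T₀ A))

module _ {o ℓ e : Level} (C : SMC o ℓ e) where
  open SMC C

  -- u : U → I is a central idempotent: the two maps U⊗U → U agree and
  -- are invertible (δ is the inverse).
  record IsCI {U : Obj} (u : U ⇒ I) : Set (ℓ ⊔ e) where
    field
      central : ρ⇒ ∘ (id ⊗₁ u) ≈ λ⇒ ∘ (u ⊗₁ id)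
      δ       : U ⇒ (U ⊗₀ U)
      δ-isoˡ  : δ ∘ (ρ⇒ ∘ (id ⊗₁ u)) ≈ id
      δ-isoʳ  : (ρ⇒ ∘ (id ⊗₁ u)) ∘ δ ≈ id

  record CI : Set (o ⊔ ℓ ⊔ e) where
    constructor ci
    field
      U    : Obj
      u    : U ⇒ I
      isCI : IsCI u
    open IsCI isCI public

  open CI

  Stiff : Set (o ⊔ ℓ ⊔ e)
  Stiff = ∀ (A : Obj) (c d : CI) → let U = CI.U c ; V = CI.U d in
    let top    : ((A ⊗₀ U) ⊗₀ V) ⇒ (A ⊗₀ V)
        top    = (id ⊗₁ λ⇒) ∘ (id ⊗₁ (u c ⊗₁ id)) ∘ α⇐
        left   : ((A ⊗₀ U) ⊗₀ V) ⇒ (A ⊗₀ U)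
        left   = ρ⇒ ∘ (id ⊗₁ u d)
        bottom : (A ⊗₀ U) ⇒ A
        bottom = ρ⇒ ∘ (id ⊗₁ u c)
        right  : (A ⊗₀ V) ⇒ A
        right  = ρ⇒ ∘ (id ⊗₁ u d)
    in ∀ (X : Obj) (f : X ⇒ (A ⊗₀ U)) (g : X ⇒ (A ⊗₀ V)) →
       bottom ∘ f ≈ right ∘ g →
       Σ (X ⇒ ((A ⊗₀ U) ⊗₀ V)) λ h →
         (left ∘ h ≈ f × top ∘ h ≈ g) ×
         (∀ (h' : X ⇒ ((A ⊗₀ U) ⊗₀ V)) → left ∘ h' ≈ f → top ∘ h' ≈ g → h' ≈ h)

  Cops : CatOps Obj ℓ e
  Cops = record { Hom = _⇒_ ; Eq = _≈_ ; idt = λ A → id ; comp = _∘_ }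

  -- the category C|_u: morphisms A → B are morphisms A ⊗ U → B
  -- (A ⊗ U ⊗ u)⁻¹ is realised as α⇒ ∘ (id ⊗ δ)
  restrict : CI → CatOps Obj ℓ e
  restrict c = record
    { Hom  = λ A B → (A ⊗₀ U c) ⇒ B
    ; Eq   = _≈_
    ; idt  = λ A → ρ⇒ ∘ (id {A} ⊗₁ u c)
    ; comp = λ g f → g ∘ (f ⊗₁ id) ∘ α⇒ ∘ (id ⊗₁ δ c)
    }

  record LocData (T₀ : Obj → Obj) : Set (o ⊔ ℓ ⊔ e) where
    field
      mon : MonadData Cops T₀
      st  : ∀ (A : Obj) (c : CI) → (T₀ A ⊗₀ U c) ⇒ T₀ (A ⊗₀ U c)
    open MonadData mon public

  record IsLocalisable {T₀ : Obj → Obj} (L : LocData T₀) : Set (o ⊔ ℓ ⊔ e) where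
    open LocData L
    field
      isMonad : IsMonad Cops T₀ mon
      st-unit : ∀ A (p : IsCI (id {I})) → map (ρ⇒ {A}) ∘ st A (ci I id p) ≈ ρ⇒
      -- the central idempotent u ⊗ v is ρ_I ∘ (u ⊗ v) : U ⊗ V → I
      st-assoc : ∀ A (c d : CI) (p : IsCI (ρ⇒ ∘ (u c ⊗₁ u d))) →
        map α⇒ ∘ st A (ci (U c ⊗₀ U d) (ρ⇒ ∘ (u c ⊗₁ u d)) p)
          ≈ st (A ⊗₀ U c) d ∘ (st A c ⊗₁ id) ∘ α⇒
      st-η : ∀ A (c : CI) → η (A ⊗₀ U c) ≈ st A c ∘ (η A ⊗₁ id)
      st-μ : ∀ A (c : CI) →
        μ (A ⊗₀ U c) ∘ map (st A c) ∘ st (T₀ A) c ≈ st A c ∘ (μ A ⊗₁ id)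
      st-m : ∀ A (c d : CI) (m : U c ⇒ U d) → u c ≈ u d ∘ m →
        st A d ∘ (id ⊗₁ m) ≈ map (id ⊗₁ m) ∘ st A c
      st-nat : ∀ {A B} (f : A ⇒ B) (c : CI) →
        st B c ∘ (map f ⊗₁ id) ≈ map (f ⊗₁ id) ∘ st A c

  -- formal monads on C̄: a monad on each C|_u (with object part T₀, which
  -- is forced to be the same for all u since every u ≤ 1), compatible
  -- with the restriction functors C|_{u≤v}
  record FormalData (T₀ : Obj → Obj) : Set (o ⊔ ℓ ⊔ e) where
    field
      mon : (c : CI) → MonadData (restrict c) T₀

  record IsFormal {T₀ : Obj → Obj} (F : FormalData T₀) : Set (o ⊔ ℓ ⊔ e) where
    open FormalData F
    open MonadData
    field
      isMonad : ∀ c → IsMonad (restrict c) T₀ (mon c)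
      restr-map : ∀ (c d : CI) (m : U c ⇒ U d) → u c ≈ u d ∘ m →
        ∀ {A B} (f : (A ⊗₀ U d) ⇒ B) →
        map (mon c) (f ∘ (id ⊗₁ m)) ≈ map (mon d) f ∘ (id ⊗₁ m)
      restr-η : ∀ (c d : CI) (m : U c ⇒ U d) → u c ≈ u d ∘ m →
        ∀ A → η (mon c) A ≈ η (mon d) A ∘ (id ⊗₁ m)
      restr-μ : ∀ (c d : CI) (m : U c ⇒ U d) → u c ≈ u d ∘ m →
        ∀ A → μ (mon c) A ≈ μ (mon d) A ∘ (id ⊗₁ m)

  Φ : ∀ {T₀} → LocData T₀ → FormalData T₀
  Φ L = record { mon = λ c → record
    { map = λ {A} f → map f ∘ st A c
    ; η   = λ A → ρ⇒ ∘ (η A ⊗₁ u c)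
    ; μ   = λ A → ρ⇒ ∘ (μ A ⊗₁ u c) } }
    where open LocData L

  -- formal monad ↦ localisable monad, given the (always existing) witness
  -- that 1 = id_I is a central idempotent
  module _ (p₁ : IsCI (id {I})) where
    one : CI
    one = ci I id p₁

    comp₁ : ∀ {A B D} → ((B ⊗₀ I) ⇒ D) → ((A ⊗₀ I) ⇒ B) → ((A ⊗₀ I) ⇒ D)
    comp₁ = CatOps.comp (restrict one)
    fromC : ∀ {A B} → A ⇒ B → (A ⊗₀ I) ⇒ B
    fromC f = f ∘ ρ⇒
    toC : ∀ {A B} → (A ⊗₀ I) ⇒ B → A ⇒ B
    toC f = f ∘ ρ⇐

    -- F = C‖_{u≤1} on morphisms: f ↦ (f ⊗ U) ∘ (A ⊗ u ⊗ U)⁻¹ ∘ (A ⊗ U ⊗ 1)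
    Fmor : (c : CI) → ∀ {A B} → ((A ⊗₀ U c) ⇒ B) → ((A ⊗₀ U c) ⊗₀ I) ⇒ (B ⊗₀ U c)
    Fmor c f = (f ⊗₁ id) ∘ (α⇒ ∘ (id ⊗₁ δ c)) ∘ (ρ⇒ ∘ (id ⊗₁ id))

    -- unit of F ⊣ G at A (in C|_u): A → GFA = A ⊗ U, the identity of A ⊗ U
    adjη : (c : CI) → ∀ A → (A ⊗₀ U c) ⇒ (A ⊗₀ U c)
    adjη c A = id
    -- counit of F ⊣ G at Y (in C|_1): FGY = Y ⊗ U → Y, given by Y ⊗ u
    adjε : (c : CI) → ∀ Y → ((Y ⊗₀ U c) ⊗₀ I) ⇒ Y
    adjε c Y = (ρ⇒ ∘ (id ⊗₁ u c)) ∘ ρ⇒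

    Ψ : ∀ {T₀} → FormalData T₀ → LocData T₀
    Ψ {T₀} F = record
      { mon = record
        { map = λ f → toC (map (mon one) (fromC f))
        ; η   = λ A → toC (η (mon one) A)
        ; μ   = λ A → toC (μ (mon one) A) }
      -- st_{A,U} = ε_{T₁FGA} ∘ F T_u η_{GA}  (composition in C|_1)
      ; st  = λ A c → toC (comp₁ (adjε c (T₀ (A ⊗₀ U c)))
                                  (Fmor c (map (mon c) (adjη c A))))
      }
      where open FormalData F
            open MonadData

  record LocEq {T₀} (L L' : LocData T₀) : Set (o ⊔ ℓ ⊔ e) where
    private module L = LocData L
    private module L' = LocData L'
    field
      map≈ : ∀ {A B} (f : A ⇒ B) → L.map f ≈ L'.map f
      η≈   : ∀ A → L.η A ≈ L'.η A
      μ≈   : ∀ A → L.μ A ≈ L'.μ A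
      st≈  : ∀ A c → L.st A c ≈ L'.st A c

  record FormalEq {T₀} (F F' : FormalData T₀) : Set (o ⊔ ℓ ⊔ e) where
    open MonadData
    private module F = FormalData F
    private module F' = FormalData F'
    field
      map≈ : ∀ c {A B} (f : (A ⊗₀ U c) ⇒ B) → map (F.mon c) f ≈ map (F'.mon c) f
      η≈   : ∀ c A → η (F.mon c) A ≈ η (F'.mon c) A
      μ≈   : ∀ c A → μ (F.mon c) A ≈ μ (F'.mon c) A

-- A localisable monad T restricts to C|_u by precomposing with its strength,
-- T|_u(f) = T(f) ∘ st; its monad laws reduce to those of T because a composite in
-- C|_u whose factors are of the form ρ ∘ (h ⊗ u) is ordinary composition in C.
-- Conversely a formal monad is determined by its component T₁ at 1: compatibility
-- with C|_{u ≤ 1} gives T_u(g) = T₁(g) ∘ T_u(id_{A⊗U}), and T_u(id_{A⊗U}) is the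
-- strength ε ∘ F T_u η. The strength axioms then follow from the monad laws of
-- the T_u; associativity is computed in C|_{u ⊗ v}, where the restrictions along
-- u ⊗ v ≤ u and u ⊗ v ≤ v compose to the associator.

module Submission where

open import Level using (Level)
open import Data.Product using (_×_; _,_)
open import Relation.Binary.Bundles using (Setoid)
open import Relation.Binary.Structures using (IsEquivalence)
import Relation.Binary.Reasoning.Setoid as SetoidReasoning
open import Defs

module Monoidal {o ℓ e : Level} (C : SMC o ℓ e) where
  open SMC C public

  module ≈ {A B : Obj} = IsEquivalence (≈-equiv {A} {B})

  hom-setoid : Obj → Obj → Setoid ℓ e
  hom-setoid A B = record { Carrier = A ⇒ B ; _≈_ = _≈_ ; isEquivalence = ≈-equiv }

  module HomReasoning {A B : Obj} = SetoidReasoning (hom-setoid A B)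
  open HomReasoning public using (begin_; _∎; step-≈-⟩; step-≈-⟨)

  infixr 4 _⟩∘⟨_ _⟩⊗⟨_
  infix 5 refl⟩∘⟨_ _⟩∘⟨refl

  _⟩∘⟨_ : ∀ {A B D} {f f' : B ⇒ D} {g g' : A ⇒ B} → f ≈ f' → g ≈ g' → f ∘ g ≈ f' ∘ g'
  _⟩∘⟨_ = ∘-resp-≈

  _⟩⊗⟨_ : ∀ {A B D E} {f f' : A ⇒ B} {g g' : D ⇒ E} → f ≈ f' → g ≈ g' → f ⊗₁ g ≈ f' ⊗₁ g'
  _⟩⊗⟨_ = ⊗-resp-≈

  refl⟩∘⟨_ : ∀ {A B D} {f : B ⇒ D} {g g' : A ⇒ B} → g ≈ g' → f ∘ g ≈ f ∘ g'
  refl⟩∘⟨ p = ∘-resp-≈ ≈.refl p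

  _⟩∘⟨refl : ∀ {A B D} {f f' : B ⇒ D} {g : A ⇒ B} → f ≈ f' → f ∘ g ≈ f' ∘ g
  p ⟩∘⟨refl = ∘-resp-≈ p ≈.refl

  sym-assoc : ∀ {A B D E} {f : A ⇒ B} {g : B ⇒ D} {h : D ⇒ E} → h ∘ (g ∘ f) ≈ (h ∘ g) ∘ f
  sym-assoc = ≈.sym assoc

  module _ {A B D} {a : B ⇒ D} {b : A ⇒ B} {c : A ⇒ D} where
    pullˡ : a ∘ b ≈ c → ∀ {X} {f : X ⇒ A} → a ∘ (b ∘ f) ≈ c ∘ f
    pullˡ p = ≈.trans sym-assoc (p ⟩∘⟨refl)

    pullʳ : a ∘ b ≈ c → ∀ {X} {f : D ⇒ X} → (f ∘ a) ∘ b ≈ f ∘ c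
    pullʳ p = ≈.trans assoc (refl⟩∘⟨ p)

  module _ {A B} {a : B ⇒ A} {b : A ⇒ B} (inverse : a ∘ b ≈ id) where
    cancelˡ : ∀ {X} {f : X ⇒ A} → a ∘ (b ∘ f) ≈ f
    cancelˡ = ≈.trans (pullˡ inverse) identityˡ

    cancelʳ : ∀ {X} {f : A ⇒ X} → (f ∘ a) ∘ b ≈ f
    cancelʳ = ≈.trans (pullʳ inverse) identityʳ

    mono : ∀ {X} {f g : X ⇒ A} → b ∘ f ≈ b ∘ g → f ≈ g
    mono {f = f} {g} p = begin
      f          ≈⟨ ≈.sym cancelˡ ⟩
      a ∘ b ∘ f  ≈⟨ refl⟩∘⟨ p ⟩
      a ∘ b ∘ g  ≈⟨ cancelˡ ⟩
      g          ∎

    epi : ∀ {X} {f g : A ⇒ X} → f ∘ a ≈ g ∘ a → f ≈ g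
    epi {f = f} {g} p = begin
      f            ≈⟨ ≈.sym cancelʳ ⟩
      (f ∘ a) ∘ b  ≈⟨ p ⟩∘⟨refl ⟩
      (g ∘ a) ∘ b  ≈⟨ cancelʳ ⟩
      g            ∎

  ⊗-∘-sym : ∀ {A B D A' B' D'} {f : B ⇒ D} {g : A ⇒ B} {f' : B' ⇒ D'} {g' : A' ⇒ B'} →
            (f ⊗₁ f') ∘ (g ⊗₁ g') ≈ (f ∘ g) ⊗₁ (f' ∘ g')
  ⊗-∘-sym = ≈.sym ⊗-∘

  ⊗-splitˡ : ∀ {A B D E} {f : A ⇒ B} {g : D ⇒ E} → f ⊗₁ g ≈ (f ⊗₁ id) ∘ (id ⊗₁ g)
  ⊗-splitˡ = ≈.trans (≈.sym identityʳ ⟩⊗⟨ ≈.sym identityˡ) ⊗-∘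

  ⊗-splitʳ : ∀ {A B D E} {f : A ⇒ B} {g : D ⇒ E} → f ⊗₁ g ≈ (id ⊗₁ g) ∘ (f ⊗₁ id)
  ⊗-splitʳ = ≈.trans (≈.sym identityˡ ⟩⊗⟨ ≈.sym identityʳ) ⊗-∘

  id⊗-∘ : ∀ {A B D E} {f : D ⇒ E} {g : B ⇒ D} → (id {A} ⊗₁ f) ∘ (id ⊗₁ g) ≈ id ⊗₁ (f ∘ g)
  id⊗-∘ = ≈.trans ⊗-∘-sym (identityˡ ⟩⊗⟨ ≈.refl)

  ⊗id-∘ : ∀ {A B D E} {f : D ⇒ E} {g : B ⇒ D} → (f ⊗₁ id {A}) ∘ (g ⊗₁ id) ≈ (f ∘ g) ⊗₁ id
  ⊗id-∘ = ≈.trans ⊗-∘-sym (≈.refl ⟩⊗⟨ identityˡ)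

  ⊗-interchange : ∀ {A B D E} {f : A ⇒ B} {g : D ⇒ E} →
                  (f ⊗₁ id) ∘ (id ⊗₁ g) ≈ (id ⊗₁ g) ∘ (f ⊗₁ id)
  ⊗-interchange = ≈.trans (≈.sym ⊗-splitˡ) ⊗-splitʳ

  ρ⇐-natural : ∀ {A B} {f : A ⇒ B} → (f ⊗₁ id) ∘ ρ⇐ ≈ ρ⇐ ∘ f
  ρ⇐-natural {f = f} = begin
    (f ⊗₁ id) ∘ ρ⇐            ≈⟨ ≈.sym (cancelˡ ρ-isoˡ) ⟩
    ρ⇐ ∘ ρ⇒ ∘ (f ⊗₁ id) ∘ ρ⇐  ≈⟨ refl⟩∘⟨ pullˡ (≈.sym ρ-natural) ⟩
    ρ⇐ ∘ (f ∘ ρ⇒) ∘ ρ⇐        ≈⟨ refl⟩∘⟨ cancelʳ ρ-isoʳ ⟩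
    ρ⇐ ∘ f                    ∎

  α⇐-natural : ∀ {A B D A' B' D'} {f : A ⇒ A'} {g : B ⇒ B'} {h : D ⇒ D'} →
               α⇐ ∘ ((f ⊗₁ g) ⊗₁ h) ≈ (f ⊗₁ (g ⊗₁ h)) ∘ α⇐
  α⇐-natural {f = f} {g} {h} = begin
    α⇐ ∘ ((f ⊗₁ g) ⊗₁ h)                 ≈⟨ refl⟩∘⟨ ≈.sym (cancelʳ α-isoʳ) ⟩
    α⇐ ∘ ((((f ⊗₁ g) ⊗₁ h) ∘ α⇒) ∘ α⇐)   ≈⟨ refl⟩∘⟨ (≈.sym α-natural ⟩∘⟨refl) ⟩
    α⇐ ∘ ((α⇒ ∘ (f ⊗₁ (g ⊗₁ h))) ∘ α⇐)   ≈⟨ refl⟩∘⟨ assoc ⟩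
    α⇐ ∘ α⇒ ∘ (f ⊗₁ (g ⊗₁ h)) ∘ α⇐       ≈⟨ cancelˡ α-isoˡ ⟩
    (f ⊗₁ (g ⊗₁ h)) ∘ α⇐                 ∎

  α⇒-id⊗id⊗ : ∀ {A B D E} {h : D ⇒ E} → (id {A ⊗₀ B} ⊗₁ h) ∘ α⇒ ≈ α⇒ ∘ (id ⊗₁ (id ⊗₁ h))
  α⇒-id⊗id⊗ = ≈.sym (≈.trans α-natural ((⊗-id ⟩⊗⟨ ≈.refl) ⟩∘⟨refl))

  ⊗I-injective : ∀ {A B} {f g : A ⇒ B} → f ⊗₁ id {I} ≈ g ⊗₁ id → f ≈ g
  ⊗I-injective {f = f} {g} p = epi ρ-isoʳ (begin
    f ∘ ρ⇒           ≈⟨ ρ-natural ⟩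
    ρ⇒ ∘ (f ⊗₁ id)   ≈⟨ refl⟩∘⟨ p ⟩
    ρ⇒ ∘ (g ⊗₁ id)   ≈⟨ ≈.sym ρ-natural ⟩
    g ∘ ρ⇒           ∎)

  I⊗-injective : ∀ {A B} {f g : A ⇒ B} → id {I} ⊗₁ f ≈ id ⊗₁ g → f ≈ g
  I⊗-injective {f = f} {g} p = epi λ-isoʳ (begin
    f ∘ λ⇒           ≈⟨ λ-natural ⟩
    λ⇒ ∘ (id ⊗₁ f)   ≈⟨ refl⟩∘⟨ p ⟩
    λ⇒ ∘ (id ⊗₁ g)   ≈⟨ ≈.sym λ-natural ⟩
    g ∘ λ⇒           ∎)

  -- Kelly's consequences of the triangle and pentagon axioms.
  id⊗ρ∘α⇐≈ρ : ∀ {X Y} → (id ⊗₁ ρ⇒) ∘ α⇐ {X} {Y} {I} ≈ ρ⇒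
  id⊗ρ∘α⇐≈ρ = ⊗I-injective (mono α-isoʳ (begin
    α⇐ ∘ (((id ⊗₁ ρ⇒) ∘ α⇐) ⊗₁ id)                      ≈⟨ refl⟩∘⟨ ≈.sym ⊗id-∘ ⟩
    α⇐ ∘ ((id ⊗₁ ρ⇒) ⊗₁ id) ∘ (α⇐ ⊗₁ id)                ≈⟨ pullˡ α⇐-natural ⟩
    ((id ⊗₁ (ρ⇒ ⊗₁ id)) ∘ α⇐) ∘ (α⇐ ⊗₁ id)              ≈⟨ assoc ⟩
    (id ⊗₁ (ρ⇒ ⊗₁ id)) ∘ α⇐ ∘ (α⇐ ⊗₁ id)                ≈⟨ (≈.refl ⟩⊗⟨ ≈.sym triangle) ⟩∘⟨refl ⟩
    (id ⊗₁ ((id ⊗₁ λ⇒) ∘ α⇐)) ∘ α⇐ ∘ (α⇐ ⊗₁ id)         ≈⟨ ≈.sym id⊗-∘ ⟩∘⟨refl ⟩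
    ((id ⊗₁ (id ⊗₁ λ⇒)) ∘ (id ⊗₁ α⇐)) ∘ α⇐ ∘ (α⇐ ⊗₁ id) ≈⟨ assoc ⟩
    (id ⊗₁ (id ⊗₁ λ⇒)) ∘ (id ⊗₁ α⇐) ∘ α⇐ ∘ (α⇐ ⊗₁ id)   ≈⟨ refl⟩∘⟨ pentagon ⟩
    (id ⊗₁ (id ⊗₁ λ⇒)) ∘ α⇐ ∘ α⇐                        ≈⟨ pullˡ (≈.sym α⇐-natural) ⟩
    (α⇐ ∘ ((id ⊗₁ id) ⊗₁ λ⇒)) ∘ α⇐                      ≈⟨ assoc ⟩
    α⇐ ∘ ((id ⊗₁ id) ⊗₁ λ⇒) ∘ α⇐                        ≈⟨ refl⟩∘⟨ ((⊗-id ⟩⊗⟨ ≈.refl) ⟩∘⟨refl) ⟩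
    α⇐ ∘ (id ⊗₁ λ⇒) ∘ α⇐                                ≈⟨ refl⟩∘⟨ triangle ⟩
    α⇐ ∘ (ρ⇒ ⊗₁ id)                                     ∎))

  ρ∘α⇒≈id⊗ρ : ∀ {X Y} → ρ⇒ ∘ α⇒ {X} {Y} {I} ≈ id ⊗₁ ρ⇒
  ρ∘α⇒≈id⊗ρ = ≈.trans (≈.sym id⊗ρ∘α⇐≈ρ ⟩∘⟨refl) (cancelʳ α-isoˡ)

  λ∘α⇐≈λ⊗id : ∀ {X Y} → λ⇒ ∘ α⇐ {I} {X} {Y} ≈ λ⇒ ⊗₁ id
  λ∘α⇐≈λ⊗id = I⊗-injective (epi α⇐∘α⇐⊗id-inverse (begin
    (id ⊗₁ (λ⇒ ∘ α⇐)) ∘ α⇐ ∘ (α⇐ ⊗₁ id)          ≈⟨ ≈.sym id⊗-∘ ⟩∘⟨refl ⟩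
    ((id ⊗₁ λ⇒) ∘ (id ⊗₁ α⇐)) ∘ α⇐ ∘ (α⇐ ⊗₁ id)  ≈⟨ assoc ⟩
    (id ⊗₁ λ⇒) ∘ (id ⊗₁ α⇐) ∘ α⇐ ∘ (α⇐ ⊗₁ id)    ≈⟨ refl⟩∘⟨ pentagon ⟩
    (id ⊗₁ λ⇒) ∘ α⇐ ∘ α⇐                        ≈⟨ pullˡ triangle ⟩
    (ρ⇒ ⊗₁ id) ∘ α⇐                             ≈⟨ (≈.refl ⟩⊗⟨ ≈.sym ⊗-id) ⟩∘⟨refl ⟩
    (ρ⇒ ⊗₁ (id ⊗₁ id)) ∘ α⇐                     ≈⟨ ≈.sym α⇐-natural ⟩
    α⇐ ∘ ((ρ⇒ ⊗₁ id) ⊗₁ id)                     ≈⟨ refl⟩∘⟨ (≈.sym triangle ⟩⊗⟨ ≈.refl) ⟩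
    α⇐ ∘ (((id ⊗₁ λ⇒) ∘ α⇐) ⊗₁ id)              ≈⟨ refl⟩∘⟨ ≈.sym ⊗id-∘ ⟩
    α⇐ ∘ ((id ⊗₁ λ⇒) ⊗₁ id) ∘ (α⇐ ⊗₁ id)        ≈⟨ pullˡ α⇐-natural ⟩
    ((id ⊗₁ (λ⇒ ⊗₁ id)) ∘ α⇐) ∘ (α⇐ ⊗₁ id)      ≈⟨ assoc ⟩
    (id ⊗₁ (λ⇒ ⊗₁ id)) ∘ α⇐ ∘ (α⇐ ⊗₁ id)        ∎))
    where
    α⇐∘α⇐⊗id-inverse : ∀ {X Y} → (α⇐ ∘ (α⇐ ⊗₁ id)) ∘ ((α⇒ ⊗₁ id) ∘ α⇒ {I} {I ⊗₀ X} {Y}) ≈ id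
    α⇐∘α⇐⊗id-inverse = begin
      (α⇐ ∘ (α⇐ ⊗₁ id)) ∘ ((α⇒ ⊗₁ id) ∘ α⇒)  ≈⟨ assoc ⟩
      α⇐ ∘ (α⇐ ⊗₁ id) ∘ (α⇒ ⊗₁ id) ∘ α⇒      ≈⟨ refl⟩∘⟨ pullˡ (≈.trans ⊗id-∘ (α-isoˡ ⟩⊗⟨ ≈.refl)) ⟩
      α⇐ ∘ (id ⊗₁ id) ∘ α⇒                   ≈⟨ refl⟩∘⟨ ≈.trans (⊗-id ⟩∘⟨refl) identityˡ ⟩
      α⇐ ∘ α⇒                                ≈⟨ α-isoˡ ⟩
      id                                     ∎

  λI≈ρI : λ⇒ {I} ≈ ρ⇒ {I}
  λI≈ρI = ⊗I-injective (begin
    λ⇒ ⊗₁ id          ≈⟨ ≈.sym λ∘α⇐≈λ⊗id ⟩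
    λ⇒ ∘ α⇐           ≈⟨ mono λ-isoˡ λ-natural ⟩∘⟨refl ⟩
    (id ⊗₁ λ⇒) ∘ α⇐   ≈⟨ triangle ⟩
    ρ⇒ ⊗₁ id          ∎)

  ρ⊗id∘α⇒≈id⊗λ : ∀ {A B} → (ρ⇒ ⊗₁ id) ∘ α⇒ ≈ id {A} ⊗₁ λ⇒ {B}
  ρ⊗id∘α⇒≈id⊗λ = ≈.trans (≈.sym triangle ⟩∘⟨refl) (cancelʳ α-isoˡ)

  α⇒∘id⊗λ⇐≈ρ⇐⊗id : ∀ {A B} → α⇒ ∘ (id {A} ⊗₁ λ⇐ {B}) ≈ ρ⇐ ⊗₁ id
  α⇒∘id⊗λ⇐≈ρ⇐⊗id = mono ρ⇐⊗id∘ρ⇒⊗id≈id (begin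
    (ρ⇒ ⊗₁ id) ∘ α⇒ ∘ (id ⊗₁ λ⇐)  ≈⟨ pullˡ ρ⊗id∘α⇒≈id⊗λ ⟩
    (id ⊗₁ λ⇒) ∘ (id ⊗₁ λ⇐)       ≈⟨ id⊗-∘ ⟩
    id ⊗₁ (λ⇒ ∘ λ⇐)               ≈⟨ ≈.trans (≈.refl ⟩⊗⟨ λ-isoʳ) ⊗-id ⟩
    id                            ≈⟨ ≈.sym (≈.trans ⊗id-∘ (≈.trans (ρ-isoʳ ⟩⊗⟨ ≈.refl) ⊗-id)) ⟩
    (ρ⇒ ⊗₁ id) ∘ (ρ⇐ ⊗₁ id)       ∎)
    where
    ρ⇐⊗id∘ρ⇒⊗id≈id : ∀ {A B} → (ρ⇐ ⊗₁ id) ∘ (ρ⇒ ⊗₁ id) ≈ id {(A ⊗₀ I) ⊗₀ B}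
    ρ⇐⊗id∘ρ⇒⊗id≈id = ≈.trans ⊗id-∘ (≈.trans (ρ-isoˡ ⟩⊗⟨ ≈.refl) ⊗-id)

  IsCI-resp-≈ : ∀ {U} {u u' : U ⇒ I} → u ≈ u' → IsCI C u → IsCI C u'
  IsCI-resp-≈ p isCI = record
    { central = ≈.trans (refl⟩∘⟨ (≈.refl ⟩⊗⟨ ≈.sym p))
                        (≈.trans central (refl⟩∘⟨ (p ⟩⊗⟨ ≈.refl)))
    ; δ = δ
    ; δ-isoˡ = ≈.trans (refl⟩∘⟨ (refl⟩∘⟨ (≈.refl ⟩⊗⟨ ≈.sym p))) δ-isoˡ
    ; δ-isoʳ = ≈.trans ((refl⟩∘⟨ (≈.refl ⟩⊗⟨ ≈.sym p)) ⟩∘⟨refl) δ-isoʳ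
    }
    where open IsCI isCI

  IsCI-∘-iso : ∀ {U W} {u : U ⇒ I} (φ : W ⇒ U) (ψ : U ⇒ W) → φ ∘ ψ ≈ id → ψ ∘ φ ≈ id →
               IsCI C u → IsCI C (u ∘ φ)
  IsCI-∘-iso {u = u} φ ψ φψ ψφ isCI = record
    { central = mono ψφ (begin
        φ ∘ ρ⇒ ∘ (id ⊗₁ (u ∘ φ))          ≈⟨ φ-square ⟩
        (ρ⇒ ∘ (id ⊗₁ u)) ∘ (φ ⊗₁ φ)       ≈⟨ central ⟩∘⟨refl ⟩
        (λ⇒ ∘ (u ⊗₁ id)) ∘ (φ ⊗₁ φ)       ≈⟨ assoc ⟩
        λ⇒ ∘ (u ⊗₁ id) ∘ (φ ⊗₁ φ)         ≈⟨ refl⟩∘⟨ ≈.trans ⊗-∘-sym (≈.refl ⟩⊗⟨ identityˡ) ⟩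
        λ⇒ ∘ ((u ∘ φ) ⊗₁ φ)               ≈⟨ refl⟩∘⟨ ⊗-splitʳ ⟩
        λ⇒ ∘ (id ⊗₁ φ) ∘ ((u ∘ φ) ⊗₁ id)  ≈⟨ pullˡ (≈.sym λ-natural) ⟩
        (φ ∘ λ⇒) ∘ ((u ∘ φ) ⊗₁ id)        ≈⟨ assoc ⟩
        φ ∘ λ⇒ ∘ ((u ∘ φ) ⊗₁ id)          ∎)
    ; δ = (ψ ⊗₁ ψ) ∘ δ ∘ φ
    ; δ-isoˡ = begin
        ((ψ ⊗₁ ψ) ∘ δ ∘ φ) ∘ ρ⇒ ∘ (id ⊗₁ (u ∘ φ))   ≈⟨ ≈.trans assoc (refl⟩∘⟨ assoc) ⟩
        (ψ ⊗₁ ψ) ∘ δ ∘ φ ∘ ρ⇒ ∘ (id ⊗₁ (u ∘ φ))     ≈⟨ refl⟩∘⟨ refl⟩∘⟨ φ-square ⟩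
        (ψ ⊗₁ ψ) ∘ δ ∘ (ρ⇒ ∘ (id ⊗₁ u)) ∘ (φ ⊗₁ φ)  ≈⟨ refl⟩∘⟨ ≈.trans (pullˡ δ-isoˡ) identityˡ ⟩
        (ψ ⊗₁ ψ) ∘ (φ ⊗₁ φ)                        ≈⟨ ≈.trans ⊗-∘-sym (≈.trans (ψφ ⟩⊗⟨ ψφ) ⊗-id) ⟩
        id                                         ∎
    ; δ-isoʳ = begin
        (ρ⇒ ∘ (id ⊗₁ (u ∘ φ))) ∘ (ψ ⊗₁ ψ) ∘ δ ∘ φ              ≈⟨ ≈.sym (cancelˡ ψφ) ⟩∘⟨refl ⟩
        (ψ ∘ φ ∘ ρ⇒ ∘ (id ⊗₁ (u ∘ φ))) ∘ (ψ ⊗₁ ψ) ∘ δ ∘ φ      ≈⟨ (refl⟩∘⟨ φ-square) ⟩∘⟨refl ⟩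
        (ψ ∘ (ρ⇒ ∘ (id ⊗₁ u)) ∘ (φ ⊗₁ φ)) ∘ (ψ ⊗₁ ψ) ∘ δ ∘ φ  ≈⟨ ≈.trans assoc (refl⟩∘⟨ assoc) ⟩
        ψ ∘ (ρ⇒ ∘ (id ⊗₁ u)) ∘ (φ ⊗₁ φ) ∘ (ψ ⊗₁ ψ) ∘ δ ∘ φ    ≈⟨ refl⟩∘⟨ refl⟩∘⟨ ≈.trans (pullˡ φ⊗φ∘ψ⊗ψ≈id) identityˡ ⟩
        ψ ∘ (ρ⇒ ∘ (id ⊗₁ u)) ∘ δ ∘ φ                          ≈⟨ refl⟩∘⟨ ≈.trans (pullˡ δ-isoʳ) identityˡ ⟩
        ψ ∘ φ                                                 ≈⟨ ψφ ⟩
        id                                                    ∎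
    }
    where
    open IsCI isCI
    φ⊗φ∘ψ⊗ψ≈id : (φ ⊗₁ φ) ∘ (ψ ⊗₁ ψ) ≈ id
    φ⊗φ∘ψ⊗ψ≈id = ≈.trans ⊗-∘-sym (≈.trans (φψ ⟩⊗⟨ φψ) ⊗-id)
    φ-square : φ ∘ ρ⇒ ∘ (id ⊗₁ (u ∘ φ)) ≈ (ρ⇒ ∘ (id ⊗₁ u)) ∘ (φ ⊗₁ φ)
    φ-square = begin
      φ ∘ ρ⇒ ∘ (id ⊗₁ (u ∘ φ))            ≈⟨ pullˡ ρ-natural ⟩
      (ρ⇒ ∘ (φ ⊗₁ id)) ∘ (id ⊗₁ (u ∘ φ))  ≈⟨ pullʳ (≈.sym ⊗-splitˡ) ⟩
      ρ⇒ ∘ (φ ⊗₁ (u ∘ φ))                 ≈⟨ refl⟩∘⟨ ≈.trans (≈.sym identityˡ ⟩⊗⟨ ≈.refl) ⊗-∘ ⟩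
      ρ⇒ ∘ (id ⊗₁ u) ∘ (φ ⊗₁ φ)           ≈⟨ sym-assoc ⟩
      (ρ⇒ ∘ (id ⊗₁ u)) ∘ (φ ⊗₁ φ)         ∎

  module Idempotent (c : CI C) where
    open CI c public

    drop : ∀ {A} → (A ⊗₀ U) ⇒ A
    drop = ρ⇒ ∘ (id ⊗₁ u)

    dup : ∀ {A} → (A ⊗₀ U) ⇒ ((A ⊗₀ U) ⊗₀ U)
    dup = α⇒ ∘ (id ⊗₁ δ)

    infixr 8 _∘ᵤ_
    _∘ᵤ_ : ∀ {A B D} → (B ⊗₀ U) ⇒ D → (A ⊗₀ U) ⇒ B → (A ⊗₀ U) ⇒ D
    g ∘ᵤ f = g ∘ (f ⊗₁ id) ∘ dup

    embed : ∀ {A B} → A ⇒ B → (A ⊗₀ U) ⇒ B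
    embed h = ρ⇒ ∘ (h ⊗₁ u)

    embed≈∘drop : ∀ {A B} {h : A ⇒ B} → embed h ≈ h ∘ drop
    embed≈∘drop = ≈.trans (refl⟩∘⟨ ⊗-splitˡ) (≈.trans (pullˡ (≈.sym ρ-natural)) assoc)

    id⊗u∘dup≈ρ⇐ : ∀ {A} → (id {A ⊗₀ U} ⊗₁ u) ∘ dup ≈ ρ⇐
    id⊗u∘dup≈ρ⇐ = ≈.trans (≈.sym (cancelˡ ρ-isoˡ)) (≈.trans (refl⟩∘⟨ drop∘dup≈id) identityʳ)
      where
      drop∘dup≈id : ρ⇒ ∘ (id ⊗₁ u) ∘ dup ≈ id
      drop∘dup≈id = begin
        ρ⇒ ∘ (id ⊗₁ u) ∘ α⇒ ∘ (id ⊗₁ δ)             ≈⟨ refl⟩∘⟨ pullˡ α⇒-id⊗id⊗ ⟩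
        ρ⇒ ∘ (α⇒ ∘ (id ⊗₁ (id ⊗₁ u))) ∘ (id ⊗₁ δ)   ≈⟨ refl⟩∘⟨ assoc ⟩
        ρ⇒ ∘ α⇒ ∘ (id ⊗₁ (id ⊗₁ u)) ∘ (id ⊗₁ δ)     ≈⟨ pullˡ ρ∘α⇒≈id⊗ρ ⟩
        (id ⊗₁ ρ⇒) ∘ (id ⊗₁ (id ⊗₁ u)) ∘ (id ⊗₁ δ)  ≈⟨ ≈.trans (refl⟩∘⟨ id⊗-∘) id⊗-∘ ⟩
        id ⊗₁ (ρ⇒ ∘ (id ⊗₁ u) ∘ δ)                  ≈⟨ ≈.refl ⟩⊗⟨ ≈.trans sym-assoc δ-isoʳ ⟩
        id ⊗₁ id                                    ≈⟨ ⊗-id ⟩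
        id                                          ∎

    id⊗u⊗id∘dup≈ρ⇐⊗id : ∀ {A} → ((id {A} ⊗₁ u) ⊗₁ id) ∘ dup ≈ ρ⇐ ⊗₁ id
    id⊗u⊗id∘dup≈ρ⇐⊗id = begin
      ((id ⊗₁ u) ⊗₁ id) ∘ α⇒ ∘ (id ⊗₁ δ)  ≈⟨ pullˡ (≈.sym α-natural) ⟩
      (α⇒ ∘ (id ⊗₁ (u ⊗₁ id))) ∘ (id ⊗₁ δ) ≈⟨ pullʳ id⊗-∘ ⟩
      α⇒ ∘ (id ⊗₁ ((u ⊗₁ id) ∘ δ))        ≈⟨ refl⟩∘⟨ (≈.refl ⟩⊗⟨ u⊗id∘δ≈λ⇐) ⟩
      α⇒ ∘ (id ⊗₁ λ⇐)                     ≈⟨ α⇒∘id⊗λ⇐≈ρ⇐⊗id ⟩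
      ρ⇐ ⊗₁ id                            ∎
      where
      u⊗id∘δ≈λ⇐ : (u ⊗₁ id) ∘ δ ≈ λ⇐
      u⊗id∘δ≈λ⇐ = begin
        (u ⊗₁ id) ∘ δ              ≈⟨ ≈.sym (cancelˡ λ-isoˡ) ⟩
        λ⇐ ∘ λ⇒ ∘ (u ⊗₁ id) ∘ δ    ≈⟨ refl⟩∘⟨ pullˡ (≈.sym central) ⟩
        λ⇐ ∘ (ρ⇒ ∘ (id ⊗₁ u)) ∘ δ  ≈⟨ refl⟩∘⟨ δ-isoʳ ⟩
        λ⇐ ∘ id                    ≈⟨ identityʳ ⟩
        λ⇐                         ∎

    ∘ᵤ-factorˡ : ∀ {A B D} {g : (B ⊗₀ I) ⇒ D} {f : (A ⊗₀ U) ⇒ B} →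
                 (g ∘ (id ⊗₁ u)) ∘ᵤ f ≈ g ∘ ρ⇐ ∘ f
    ∘ᵤ-factorˡ {g = g} {f} = begin
      (g ∘ (id ⊗₁ u)) ∘ (f ⊗₁ id) ∘ dup  ≈⟨ assoc ⟩
      g ∘ (id ⊗₁ u) ∘ (f ⊗₁ id) ∘ dup    ≈⟨ refl⟩∘⟨ pullˡ (≈.sym ⊗-interchange) ⟩
      g ∘ ((f ⊗₁ id) ∘ (id ⊗₁ u)) ∘ dup  ≈⟨ refl⟩∘⟨ pullʳ id⊗u∘dup≈ρ⇐ ⟩
      g ∘ (f ⊗₁ id) ∘ ρ⇐                 ≈⟨ refl⟩∘⟨ ρ⇐-natural ⟩
      g ∘ ρ⇐ ∘ f                         ∎

    ∘ᵤ-factorʳ : ∀ {A B D} {g : (B ⊗₀ U) ⇒ D} {h : (A ⊗₀ I) ⇒ B} →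
                 g ∘ᵤ (h ∘ (id ⊗₁ u)) ≈ g ∘ ((h ∘ ρ⇐) ⊗₁ id)
    ∘ᵤ-factorʳ {g = g} {h} = refl⟩∘⟨ (begin
      ((h ∘ (id ⊗₁ u)) ⊗₁ id) ∘ dup          ≈⟨ ≈.sym ⊗id-∘ ⟩∘⟨refl ⟩
      ((h ⊗₁ id) ∘ ((id ⊗₁ u) ⊗₁ id)) ∘ dup  ≈⟨ pullʳ id⊗u⊗id∘dup≈ρ⇐⊗id ⟩
      (h ⊗₁ id) ∘ (ρ⇐ ⊗₁ id)                 ≈⟨ ⊗id-∘ ⟩
      (h ∘ ρ⇐) ⊗₁ id                         ∎)

    ∘ᵤ-embedˡ : ∀ {A B D} {g : B ⇒ D} {f : (A ⊗₀ U) ⇒ B} → embed g ∘ᵤ f ≈ g ∘ f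
    ∘ᵤ-embedˡ {g = g} {f} = begin
      embed g ∘ᵤ f                 ≈⟨ ≈.trans embed≈∘drop sym-assoc ⟩∘⟨refl ⟩
      ((g ∘ ρ⇒) ∘ (id ⊗₁ u)) ∘ᵤ f  ≈⟨ ∘ᵤ-factorˡ ⟩
      (g ∘ ρ⇒) ∘ ρ⇐ ∘ f            ≈⟨ pullʳ (cancelˡ ρ-isoʳ) ⟩
      g ∘ f                        ∎

    ∘ᵤ-embedʳ : ∀ {A B D} {g : (B ⊗₀ U) ⇒ D} {h : A ⇒ B} → g ∘ᵤ embed h ≈ g ∘ (h ⊗₁ id)
    ∘ᵤ-embedʳ {g = g} {h} = begin
      g ∘ᵤ embed h                 ≈⟨ refl⟩∘⟨ ((≈.trans embed≈∘drop sym-assoc ⟩⊗⟨ ≈.refl) ⟩∘⟨refl) ⟩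
      g ∘ᵤ ((h ∘ ρ⇒) ∘ (id ⊗₁ u))  ≈⟨ ∘ᵤ-factorʳ ⟩
      g ∘ (((h ∘ ρ⇒) ∘ ρ⇐) ⊗₁ id)  ≈⟨ refl⟩∘⟨ (cancelʳ ρ-isoʳ ⟩⊗⟨ ≈.refl) ⟩
      g ∘ (h ⊗₁ id)                ∎

    embed-∘ : ∀ {A B D} {a : B ⇒ D} {b : A ⇒ B} → embed a ∘ (b ⊗₁ id) ≈ (a ∘ b) ∘ drop
    embed-∘ {a = a} {b} = begin
      embed a ∘ (b ⊗₁ id)         ≈⟨ pullʳ (≈.trans ⊗-∘-sym (≈.refl ⟩⊗⟨ identityʳ)) ⟩
      embed (a ∘ b)               ≈⟨ embed≈∘drop ⟩
      (a ∘ b) ∘ drop              ∎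

    self-meet : CI C
    self-meet = ci (U ⊗₀ U) (embed u) isCI-u⊗u
      where
      isCI-u⊗u : IsCI C (embed u)
      isCI-u⊗u = IsCI-resp-≈ (≈.sym embed≈∘drop) (IsCI-∘-iso drop δ δ-isoʳ δ-isoˡ isCI)

    u≈[u⊗u]∘δ : u ≈ embed u ∘ δ
    u≈[u⊗u]∘δ = ≈.sym (≈.trans (embed≈∘drop ⟩∘⟨refl) (≈.trans (pullʳ δ-isoʳ) identityʳ))

  module Meet (c d : CI C) (isCI-w : IsCI C (ρ⇒ ∘ (CI.u c ⊗₁ CI.u d))) where
    open CI c using (U; u)
    open CI d using () renaming (U to V; u to v; central to v-central)

    w : (U ⊗₀ V) ⇒ I
    w = ρ⇒ ∘ (u ⊗₁ v)

    meet : CI C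
    meet = ci (U ⊗₀ V) w isCI-w

    πU : (U ⊗₀ V) ⇒ U
    πU = ρ⇒ ∘ (id ⊗₁ v)

    πV : (U ⊗₀ V) ⇒ V
    πV = λ⇒ ∘ (u ⊗₁ id)

    w≈u∘πU : w ≈ u ∘ πU
    w≈u∘πU = ≈.sym (≈.trans (pullˡ ρ-natural) (pullʳ (≈.sym ⊗-splitˡ)))

    w≈v∘πV : w ≈ v ∘ πV
    w≈v∘πV = ≈.sym (≈.trans (pullˡ λ-natural) (≈.trans (pullʳ (≈.sym ⊗-splitʳ)) (λI≈ρI ⟩∘⟨refl)))

    πU⊗πV≈id⊗w : πU ⊗₁ πV ≈ ρ⇒ ∘ (id ⊗₁ w)
    πU⊗πV≈id⊗w = begin
      πU ⊗₁ πV                                     ≈⟨ ≈.sym πU⊗πV-via-λ ⟩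
      (id ⊗₁ (λ⇒ ∘ (v ⊗₁ id))) ∘ α⇐ ∘ (id ⊗₁ πV)   ≈⟨ (≈.refl ⟩⊗⟨ ≈.sym v-central) ⟩∘⟨refl ⟩
      (id ⊗₁ (ρ⇒ ∘ (id ⊗₁ v))) ∘ α⇐ ∘ (id ⊗₁ πV)   ≈⟨ id⊗w-via-ρ ⟩
      ρ⇒ ∘ (id ⊗₁ w)                               ∎
      where
      πU⊗πV-via-λ : (id ⊗₁ (λ⇒ ∘ (v ⊗₁ id))) ∘ α⇐ ∘ (id ⊗₁ πV) ≈ πU ⊗₁ πV
      πU⊗πV-via-λ = begin
        (id ⊗₁ (λ⇒ ∘ (v ⊗₁ id))) ∘ α⇐ ∘ (id ⊗₁ πV)           ≈⟨ ≈.sym id⊗-∘ ⟩∘⟨refl ⟩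
        ((id ⊗₁ λ⇒) ∘ (id ⊗₁ (v ⊗₁ id))) ∘ α⇐ ∘ (id ⊗₁ πV)   ≈⟨ assoc ⟩
        (id ⊗₁ λ⇒) ∘ (id ⊗₁ (v ⊗₁ id)) ∘ α⇐ ∘ (id ⊗₁ πV)     ≈⟨ refl⟩∘⟨ pullˡ (≈.sym α⇐-natural) ⟩
        (id ⊗₁ λ⇒) ∘ (α⇐ ∘ ((id ⊗₁ v) ⊗₁ id)) ∘ (id ⊗₁ πV)   ≈⟨ refl⟩∘⟨ assoc ⟩
        (id ⊗₁ λ⇒) ∘ α⇐ ∘ ((id ⊗₁ v) ⊗₁ id) ∘ (id ⊗₁ πV)     ≈⟨ pullˡ triangle ⟩
        (ρ⇒ ⊗₁ id) ∘ ((id ⊗₁ v) ⊗₁ id) ∘ (id ⊗₁ πV)         ≈⟨ refl⟩∘⟨ ≈.sym ⊗-splitˡ ⟩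
        (ρ⇒ ⊗₁ id) ∘ ((id ⊗₁ v) ⊗₁ πV)                      ≈⟨ ≈.trans ⊗-∘-sym (≈.refl ⟩⊗⟨ identityˡ) ⟩
        πU ⊗₁ πV                                            ∎
      id⊗w-via-ρ : (id ⊗₁ (ρ⇒ ∘ (id ⊗₁ v))) ∘ α⇐ ∘ (id ⊗₁ πV) ≈ ρ⇒ ∘ (id ⊗₁ w)
      id⊗w-via-ρ = begin
        (id ⊗₁ (ρ⇒ ∘ (id ⊗₁ v))) ∘ α⇐ ∘ (id ⊗₁ πV)           ≈⟨ ≈.sym id⊗-∘ ⟩∘⟨refl ⟩
        ((id ⊗₁ ρ⇒) ∘ (id ⊗₁ (id ⊗₁ v))) ∘ α⇐ ∘ (id ⊗₁ πV)   ≈⟨ assoc ⟩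
        (id ⊗₁ ρ⇒) ∘ (id ⊗₁ (id ⊗₁ v)) ∘ α⇐ ∘ (id ⊗₁ πV)     ≈⟨ refl⟩∘⟨ pullˡ (≈.sym α⇐-natural) ⟩
        (id ⊗₁ ρ⇒) ∘ (α⇐ ∘ ((id ⊗₁ id) ⊗₁ v)) ∘ (id ⊗₁ πV)   ≈⟨ refl⟩∘⟨ assoc ⟩
        (id ⊗₁ ρ⇒) ∘ α⇐ ∘ ((id ⊗₁ id) ⊗₁ v) ∘ (id ⊗₁ πV)     ≈⟨ pullˡ id⊗ρ∘α⇐≈ρ ⟩
        ρ⇒ ∘ ((id ⊗₁ id) ⊗₁ v) ∘ (id ⊗₁ πV)                 ≈⟨ refl⟩∘⟨ ((⊗-id ⟩⊗⟨ ≈.refl) ⟩∘⟨refl) ⟩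
        ρ⇒ ∘ (id ⊗₁ v) ∘ (id ⊗₁ πV)                         ≈⟨ refl⟩∘⟨ id⊗-∘ ⟩
        ρ⇒ ∘ (id ⊗₁ (v ∘ πV))                               ≈⟨ refl⟩∘⟨ (≈.refl ⟩⊗⟨ ≈.sym w≈v∘πV) ⟩
        ρ⇒ ∘ (id ⊗₁ w)                                      ∎

    open Idempotent meet using (dup; _∘ᵤ_)

    ∘ᵤ-projections : ∀ {A B} (x : (A ⊗₀ U) ⇒ B) →
                     (id ⊗₁ πV) ∘ᵤ (x ∘ (id ⊗₁ πU)) ≈ (x ⊗₁ id) ∘ α⇒
    ∘ᵤ-projections x = begin
      (id ⊗₁ πV) ∘ ((x ∘ (id ⊗₁ πU)) ⊗₁ id) ∘ dup    ≈⟨ pullˡ (≈.trans ⊗-∘-sym (identityˡ ⟩⊗⟨ identityʳ)) ⟩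
      ((x ∘ (id ⊗₁ πU)) ⊗₁ πV) ∘ dup                 ≈⟨ ≈.trans (≈.refl ⟩⊗⟨ ≈.sym identityˡ) ⊗-∘ ⟩∘⟨refl ⟩
      ((x ⊗₁ id) ∘ ((id ⊗₁ πU) ⊗₁ πV)) ∘ dup         ≈⟨ assoc ⟩
      (x ⊗₁ id) ∘ ((id ⊗₁ πU) ⊗₁ πV) ∘ α⇒ ∘ (id ⊗₁ δ) ≈⟨ refl⟩∘⟨ pullˡ (≈.sym α-natural) ⟩
      (x ⊗₁ id) ∘ (α⇒ ∘ (id ⊗₁ (πU ⊗₁ πV))) ∘ (id ⊗₁ δ) ≈⟨ refl⟩∘⟨ pullʳ id⊗-∘ ⟩
      (x ⊗₁ id) ∘ α⇒ ∘ (id ⊗₁ ((πU ⊗₁ πV) ∘ δ))       ≈⟨ refl⟩∘⟨ refl⟩∘⟨ ≈.trans (≈.refl ⟩⊗⟨ πU⊗πV∘δ≈id) ⊗-id ⟩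
      (x ⊗₁ id) ∘ α⇒ ∘ id                            ≈⟨ refl⟩∘⟨ identityʳ ⟩
      (x ⊗₁ id) ∘ α⇒                                 ∎
      where
      open IsCI isCI-w using (δ)
      πU⊗πV∘δ≈id : (πU ⊗₁ πV) ∘ δ ≈ id
      πU⊗πV∘δ≈id = ≈.trans (πU⊗πV≈id⊗w ⟩∘⟨refl) (IsCI.δ-isoʳ isCI-w)

  module UnitIdempotent (p₁ : IsCI C (id {I})) where
    open Idempotent (one C p₁) using (id⊗u∘dup≈ρ⇐) renaming (dup to dup₁; _∘ᵤ_ to _∘₁_)

    dup₁≈ρ⇐ : ∀ {A} → dup₁ {A} ≈ ρ⇐
    dup₁≈ρ⇐ = ≈.trans (≈.sym (≈.trans (⊗-id ⟩∘⟨refl) identityˡ)) id⊗u∘dup≈ρ⇐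

    toC-∘₁ : ∀ {A B D} {a : (B ⊗₀ I) ⇒ D} {b : (A ⊗₀ I) ⇒ B} →
             (a ∘₁ b) ∘ ρ⇐ ≈ (a ∘ ρ⇐) ∘ (b ∘ ρ⇐)
    toC-∘₁ {a = a} {b} = begin
      (a ∘ (b ⊗₁ id) ∘ dup₁) ∘ ρ⇐  ≈⟨ ≈.trans assoc (refl⟩∘⟨ ((refl⟩∘⟨ dup₁≈ρ⇐) ⟩∘⟨refl)) ⟩
      a ∘ ((b ⊗₁ id) ∘ ρ⇐) ∘ ρ⇐   ≈⟨ refl⟩∘⟨ (ρ⇐-natural ⟩∘⟨refl) ⟩
      a ∘ (ρ⇐ ∘ b) ∘ ρ⇐           ≈⟨ refl⟩∘⟨ assoc ⟩
      a ∘ ρ⇐ ∘ b ∘ ρ⇐             ≈⟨ sym-assoc ⟩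
      (a ∘ ρ⇐) ∘ (b ∘ ρ⇐)         ∎

    toC[ε∘Fg]≈g : ∀ (c : CI C) {X Y} (g : (X ⊗₀ CI.U c) ⇒ Y) →
                  toC C p₁ (comp₁ C p₁ (adjε C p₁ c Y) (Fmor C p₁ c g)) ≈ g
    toC[ε∘Fg]≈g c g = begin
      ((drop ∘ ρ⇒) ∘₁ Fg) ∘ ρ⇐           ≈⟨ toC-∘₁ ⟩
      ((drop ∘ ρ⇒) ∘ ρ⇐) ∘ (Fg ∘ ρ⇐)     ≈⟨ cancelʳ ρ-isoʳ ⟩∘⟨ Fg∘ρ⇐ ⟩
      drop ∘ (g ⊗₁ id) ∘ dup             ≈⟨ ∘ᵤ-factorˡ ⟩
      ρ⇒ ∘ ρ⇐ ∘ g                        ≈⟨ cancelˡ ρ-isoʳ ⟩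
      g                                  ∎
      where
      open Idempotent c using (drop; dup; ∘ᵤ-factorˡ)
      Fg = Fmor C p₁ c g
      Fg∘ρ⇐ : Fg ∘ ρ⇐ ≈ (g ⊗₁ id) ∘ dup
      Fg∘ρ⇐ = begin
        ((g ⊗₁ id) ∘ dup ∘ (ρ⇒ ∘ (id ⊗₁ id))) ∘ ρ⇐  ≈⟨ (refl⟩∘⟨ refl⟩∘⟨ ≈.trans (refl⟩∘⟨ ⊗-id) identityʳ) ⟩∘⟨refl ⟩
        ((g ⊗₁ id) ∘ dup ∘ ρ⇒) ∘ ρ⇐                ≈⟨ pullʳ (pullʳ ρ-isoʳ) ⟩
        (g ⊗₁ id) ∘ dup ∘ id                       ≈⟨ refl⟩∘⟨ identityʳ ⟩
        (g ⊗₁ id) ∘ dup                            ∎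

module LocalisableToFormal {o ℓ e : Level} (C : SMC o ℓ e) (p₁ : IsCI C (SMC.id C {SMC.I C}))
  {T₀ : SMC.Obj C → SMC.Obj C} (L : LocData C T₀) (isL : IsLocalisable C L) where
  open Monoidal C
  open LocData L
  open IsLocalisable isL
  private module T = IsMonad isMonad

  module _ (c : CI C) where
    open Idempotent c
    open MonadData (FormalData.mon (Φ C L) c) using () renaming (map to map|ᵤ)

    map-drop : ∀ {A} → map drop ∘ st A c ≈ drop
    map-drop {A} = begin
      map (ρ⇒ ∘ (id ⊗₁ u)) ∘ st A c         ≈⟨ T.map-comp _ _ ⟩∘⟨refl ⟩
      (map ρ⇒ ∘ map (id ⊗₁ u)) ∘ st A c     ≈⟨ pullʳ (≈.sym (st-m A c (one C p₁) u (≈.sym identityˡ))) ⟩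
      map ρ⇒ ∘ st A (one C p₁) ∘ (id ⊗₁ u)  ≈⟨ pullˡ (st-unit A p₁) ⟩
      drop                                  ∎

    map-embed : ∀ {A B} {h : A ⇒ B} → map (embed h) ∘ st A c ≈ map h ∘ drop
    map-embed {A} {B} {h} = begin
      map (embed h) ∘ st A c           ≈⟨ T.map-resp embed≈∘drop ⟩∘⟨refl ⟩
      map (h ∘ drop) ∘ st A c          ≈⟨ T.map-comp _ _ ⟩∘⟨refl ⟩
      (map h ∘ map drop) ∘ st A c      ≈⟨ pullʳ map-drop ⟩
      map h ∘ drop                     ∎

    -- Functoriality of T|_u comes from associativity of the strength at u ⊗ u ≅ u.
    map-∘ᵤ : ∀ {A B D} (g : (B ⊗₀ U) ⇒ D) (f : (A ⊗₀ U) ⇒ B) → map|ᵤ (g ∘ᵤ f) ≈ map|ᵤ g ∘ᵤ map|ᵤ f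
    map-∘ᵤ {A} {B} {D} g f = ≈.sym (begin
      (map g ∘ st B c) ∘ ((map f ∘ st A c) ⊗₁ id) ∘ dup             ≈⟨ assoc ⟩
      map g ∘ st B c ∘ ((map f ∘ st A c) ⊗₁ id) ∘ dup               ≈⟨ refl⟩∘⟨ refl⟩∘⟨ (≈.sym ⊗id-∘ ⟩∘⟨refl) ⟩
      map g ∘ st B c ∘ ((map f ⊗₁ id) ∘ (st A c ⊗₁ id)) ∘ dup       ≈⟨ refl⟩∘⟨ refl⟩∘⟨ assoc ⟩
      map g ∘ st B c ∘ (map f ⊗₁ id) ∘ (st A c ⊗₁ id) ∘ dup         ≈⟨ refl⟩∘⟨ pullˡ (st-nat f c) ⟩
      map g ∘ (map (f ⊗₁ id) ∘ st (A ⊗₀ U) c) ∘ (st A c ⊗₁ id) ∘ dup ≈⟨ refl⟩∘⟨ assoc ⟩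
      map g ∘ map (f ⊗₁ id) ∘ st (A ⊗₀ U) c ∘ (st A c ⊗₁ id) ∘ α⇒ ∘ (id ⊗₁ δ) ≈⟨ refl⟩∘⟨ refl⟩∘⟨ strength-twice ⟩
      map g ∘ map (f ⊗₁ id) ∘ map dup ∘ st A c                      ≈⟨ refl⟩∘⟨ pullˡ (≈.sym (T.map-comp _ _)) ⟩
      map g ∘ map ((f ⊗₁ id) ∘ dup) ∘ st A c                        ≈⟨ pullˡ (≈.sym (T.map-comp _ _)) ⟩
      map (g ∘ᵤ f) ∘ st A c                                         ∎)
      where
      strength-twice : st (A ⊗₀ U) c ∘ (st A c ⊗₁ id) ∘ α⇒ ∘ (id ⊗₁ δ) ≈ map dup ∘ st A c
      strength-twice = begin
        st (A ⊗₀ U) c ∘ (st A c ⊗₁ id) ∘ α⇒ ∘ (id ⊗₁ δ)  ≈⟨ ≈.trans (refl⟩∘⟨ sym-assoc) sym-assoc ⟩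
        (st (A ⊗₀ U) c ∘ (st A c ⊗₁ id) ∘ α⇒) ∘ (id ⊗₁ δ) ≈⟨ ≈.sym (st-assoc A c c (CI.isCI self-meet)) ⟩∘⟨refl ⟩
        (map α⇒ ∘ st A self-meet) ∘ (id ⊗₁ δ)            ≈⟨ pullʳ (st-m A c self-meet δ u≈[u⊗u]∘δ) ⟩
        map α⇒ ∘ map (id ⊗₁ δ) ∘ st A c                  ≈⟨ pullˡ (≈.sym (T.map-comp _ _)) ⟩
        map dup ∘ st A c                                 ∎

    restricted-isMonad : IsMonad (restrict C c) T₀ (FormalData.mon (Φ C L) c)
    restricted-isMonad = record
      { map-resp = λ p → T.map-resp p ⟩∘⟨refl
      ; map-id = map-drop
      ; map-comp = map-∘ᵤ
      ; η-natural = λ {A} {B} f → begin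
          embed (η B) ∘ᵤ f                    ≈⟨ ∘ᵤ-embedˡ ⟩
          η B ∘ f                             ≈⟨ T.η-natural f ⟩
          map f ∘ η (A ⊗₀ U)                  ≈⟨ refl⟩∘⟨ st-η A c ⟩
          map f ∘ st A c ∘ (η A ⊗₁ id)        ≈⟨ ≈.trans sym-assoc (≈.sym ∘ᵤ-embedʳ) ⟩
          (map f ∘ st A c) ∘ᵤ embed (η A)     ∎
      ; μ-natural = λ {A} {B} f → begin
          embed (μ B) ∘ᵤ (map (map f ∘ st A c) ∘ st (T₀ A) c)         ≈⟨ ∘ᵤ-embedˡ ⟩
          μ B ∘ map (map f ∘ st A c) ∘ st (T₀ A) c                   ≈⟨ refl⟩∘⟨ ≈.trans (T.map-comp _ _ ⟩∘⟨refl) assoc ⟩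
          μ B ∘ map (map f) ∘ map (st A c) ∘ st (T₀ A) c             ≈⟨ pullˡ (T.μ-natural f) ⟩
          (map f ∘ μ (A ⊗₀ U)) ∘ map (st A c) ∘ st (T₀ A) c          ≈⟨ pullʳ (st-μ A c) ⟩
          map f ∘ st A c ∘ (μ A ⊗₁ id)                               ≈⟨ ≈.trans sym-assoc (≈.sym ∘ᵤ-embedʳ) ⟩
          (map f ∘ st A c) ∘ᵤ embed (μ A)                            ∎
      ; μ-assoc = λ A → begin
          embed (μ A) ∘ᵤ (map (embed (μ A)) ∘ st (T₀ (T₀ A)) c)  ≈⟨ ∘ᵤ-embedˡ ⟩
          μ A ∘ map (embed (μ A)) ∘ st (T₀ (T₀ A)) c            ≈⟨ refl⟩∘⟨ map-embed ⟩
          μ A ∘ map (μ A) ∘ drop                                ≈⟨ pullˡ (T.μ-assoc A) ⟩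
          (μ A ∘ μ (T₀ A)) ∘ drop                               ≈⟨ ≈.sym embed-∘ ⟩
          embed (μ A) ∘ (μ (T₀ A) ⊗₁ id)                        ≈⟨ ≈.sym ∘ᵤ-embedʳ ⟩
          embed (μ A) ∘ᵤ embed (μ (T₀ A))                       ∎
      ; μ-unitˡ = λ A → begin
          embed (μ A) ∘ᵤ embed (η (T₀ A))      ≈⟨ ∘ᵤ-embedʳ ⟩
          embed (μ A) ∘ (η (T₀ A) ⊗₁ id)       ≈⟨ embed-∘ ⟩
          (μ A ∘ η (T₀ A)) ∘ drop              ≈⟨ ≈.trans (T.μ-unitˡ A ⟩∘⟨refl) identityˡ ⟩
          drop                                 ∎
      ; μ-unitʳ = λ A → begin
          embed (μ A) ∘ᵤ (map (embed (η A)) ∘ st A c)  ≈⟨ ∘ᵤ-embedˡ ⟩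
          μ A ∘ map (embed (η A)) ∘ st A c             ≈⟨ refl⟩∘⟨ map-embed ⟩
          μ A ∘ map (η A) ∘ drop                       ≈⟨ ≈.trans (pullˡ (T.μ-unitʳ A)) identityˡ ⟩
          drop                                         ∎
      }

  isFormal : IsFormal C (Φ C L)
  isFormal = record
    { isMonad = restricted-isMonad
    ; restr-map = λ c d m u≤v {A} {B} f → begin
        map (f ∘ (id ⊗₁ m)) ∘ st A c      ≈⟨ T.map-comp _ _ ⟩∘⟨refl ⟩
        (map f ∘ map (id ⊗₁ m)) ∘ st A c  ≈⟨ pullʳ (≈.sym (st-m A c d m u≤v)) ⟩
        map f ∘ st A d ∘ (id ⊗₁ m)        ≈⟨ sym-assoc ⟩
        (map f ∘ st A d) ∘ (id ⊗₁ m)      ∎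
    ; restr-η = λ c d m u≤v A → embed-restrict u≤v
    ; restr-μ = λ c d m u≤v A → embed-restrict u≤v
    }
    where
    embed-restrict : ∀ {A B U V} {h : A ⇒ B} {u : U ⇒ I} {v : V ⇒ I} {m : U ⇒ V} →
                     u ≈ v ∘ m → ρ⇒ ∘ (h ⊗₁ u) ≈ (ρ⇒ ∘ (h ⊗₁ v)) ∘ (id ⊗₁ m)
    embed-restrict u≤v = ≈.sym (pullʳ (≈.trans ⊗-∘-sym (identityʳ ⟩⊗⟨ ≈.sym u≤v)))

  ΨΦ≈id : LocEq C L (Ψ C p₁ (Φ C L))
  ΨΦ≈id = record
    { map≈ = λ {A} {B} f → ≈.sym (begin
        (map (f ∘ ρ⇒) ∘ st A (one C p₁)) ∘ ρ⇐  ≈⟨ (T.map-comp _ _ ⟩∘⟨refl) ⟩∘⟨refl ⟩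
        ((map f ∘ map ρ⇒) ∘ st A (one C p₁)) ∘ ρ⇐ ≈⟨ pullʳ (st-unit A p₁) ⟩∘⟨refl ⟩
        (map f ∘ ρ⇒) ∘ ρ⇐                     ≈⟨ cancelʳ ρ-isoʳ ⟩
        map f                                 ∎)
    ; η≈ = λ A → ≈.sym (≈.trans (≈.sym ρ-natural ⟩∘⟨refl) (cancelʳ ρ-isoʳ))
    ; μ≈ = λ A → ≈.sym (≈.trans (≈.sym ρ-natural ⟩∘⟨refl) (cancelʳ ρ-isoʳ))
    ; st≈ = λ A c → ≈.sym (≈.trans (UnitIdempotent.toC[ε∘Fg]≈g p₁ c _) (≈.trans (T.map-id ⟩∘⟨refl) identityˡ))
    }

module FormalToLocalisable {o ℓ e : Level} (C : SMC o ℓ e) (p₁ : IsCI C (SMC.id C {SMC.I C}))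
  {T₀ : SMC.Obj C → SMC.Obj C} (F : FormalData C T₀) (isF : IsFormal C F) where
  open Monoidal C
  open UnitIdempotent p₁
  open FormalData F
  open IsFormal isF
  private
    module L = LocData (Ψ C p₁ F)
    module Tᵤ (c : CI C) = IsMonad (isMonad c)

    𝟏 : CI C
    𝟏 = one C p₁

  Tmap : (c : CI C) → ∀ {A B} → (A ⊗₀ CI.U c) ⇒ B → (T₀ A ⊗₀ CI.U c) ⇒ T₀ B
  Tmap c = MonadData.map (mon c)

  Tη : (c : CI C) → ∀ A → (A ⊗₀ CI.U c) ⇒ T₀ A
  Tη c = MonadData.η (mon c)

  Tμ : (c : CI C) → ∀ A → (T₀ (T₀ A) ⊗₀ CI.U c) ⇒ T₀ A
  Tμ c = MonadData.μ (mon c)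

  u≤1 : ∀ (c : CI C) → CI.u c ≈ id ∘ CI.u c
  u≤1 c = ≈.sym identityˡ

  -- Restricting along u ≤ 1 shows that each T_u is determined by T_1 and T_u(id) = st.
  Tmap≈map∘Tmap-id : ∀ (c : CI C) {X Y} (g : (X ⊗₀ CI.U c) ⇒ Y) → Tmap c g ≈ L.map g ∘ Tmap c id
  Tmap≈map∘Tmap-id c g = begin
    Tmap c g                                      ≈⟨ Tᵤ.map-resp c (≈.sym g-factors) ⟩
    Tmap c (((g ∘ ρ⇒) ∘ (id ⊗₁ u)) ∘ᵤ id)         ≈⟨ Tᵤ.map-comp c _ _ ⟩
    Tmap c ((g ∘ ρ⇒) ∘ (id ⊗₁ u)) ∘ᵤ Tmap c id    ≈⟨ restr-map c 𝟏 u (u≤1 c) (g ∘ ρ⇒) ⟩∘⟨refl ⟩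
    (Tmap 𝟏 (g ∘ ρ⇒) ∘ (id ⊗₁ u)) ∘ᵤ Tmap c id    ≈⟨ ∘ᵤ-factorˡ ⟩
    Tmap 𝟏 (g ∘ ρ⇒) ∘ ρ⇐ ∘ Tmap c id              ≈⟨ sym-assoc ⟩
    L.map g ∘ Tmap c id                           ∎
    where
    open Idempotent c
    g-factors : ((g ∘ ρ⇒) ∘ (id ⊗₁ u)) ∘ᵤ id ≈ g
    g-factors = ≈.trans ∘ᵤ-factorˡ (≈.trans (refl⟩∘⟨ identityʳ) (cancelʳ ρ-isoʳ))

  st≈Tmap-id : ∀ (c : CI C) A → L.st A c ≈ Tmap c id
  st≈Tmap-id c A = toC[ε∘Fg]≈g c (Tmap c id)

  drop₁∘ρ⇐≈id : ∀ {A} → (ρ⇒ ∘ (id ⊗₁ id)) ∘ ρ⇐ ≈ id {A}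
  drop₁∘ρ⇐≈id = ≈.trans ((refl⟩∘⟨ ⊗-id) ⟩∘⟨refl) (≈.trans (identityʳ ⟩∘⟨refl) ρ-isoʳ)

  Tmap₁-toC-fromC : ∀ {A B} {x : (A ⊗₀ I) ⇒ B} → Tmap 𝟏 ((x ∘ ρ⇐) ∘ ρ⇒) ≈ Tmap 𝟏 x
  Tmap₁-toC-fromC = Tᵤ.map-resp 𝟏 (cancelʳ ρ-isoˡ)

  open Idempotent 𝟏 using () renaming (_∘ᵤ_ to _∘₁_)

  map-∘ : ∀ {A B D} (g : B ⇒ D) (f : A ⇒ B) → L.map (g ∘ f) ≈ L.map g ∘ L.map f
  map-∘ g f = begin
    Tmap 𝟏 ((g ∘ f) ∘ ρ⇒) ∘ ρ⇐                   ≈⟨ Tᵤ.map-resp 𝟏 (epi ρ-isoˡ fromC-∘) ⟩∘⟨refl ⟩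
    Tmap 𝟏 ((g ∘ ρ⇒) ∘₁ (f ∘ ρ⇒)) ∘ ρ⇐           ≈⟨ Tᵤ.map-comp 𝟏 _ _ ⟩∘⟨refl ⟩
    (Tmap 𝟏 (g ∘ ρ⇒) ∘₁ Tmap 𝟏 (f ∘ ρ⇒)) ∘ ρ⇐    ≈⟨ toC-∘₁ ⟩
    L.map g ∘ L.map f                           ∎
    where
    fromC-∘ : ((g ∘ f) ∘ ρ⇒) ∘ ρ⇐ ≈ ((g ∘ ρ⇒) ∘₁ (f ∘ ρ⇒)) ∘ ρ⇐
    fromC-∘ = ≈.sym (≈.trans toC-∘₁ (≈.trans (cancelʳ ρ-isoʳ ⟩∘⟨ cancelʳ ρ-isoʳ) (≈.sym (cancelʳ ρ-isoʳ))))

  isMonad₁ : IsMonad (Cops C) T₀ L.mon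
  isMonad₁ = record
    { map-resp = λ p → Tᵤ.map-resp 𝟏 (p ⟩∘⟨refl) ⟩∘⟨refl
    ; map-id = ≈.trans (Tᵤ.map-resp 𝟏 (≈.trans identityˡ (≈.sym (≈.trans (refl⟩∘⟨ ⊗-id) identityʳ))) ⟩∘⟨refl)
                       (≈.trans (Tᵤ.map-id 𝟏 ⟩∘⟨refl) drop₁∘ρ⇐≈id)
    ; map-comp = map-∘
    ; η-natural = λ {A} {B} f → begin
        (Tη 𝟏 B ∘ ρ⇐) ∘ f                      ≈⟨ refl⟩∘⟨ ≈.sym (cancelʳ ρ-isoʳ) ⟩
        (Tη 𝟏 B ∘ ρ⇐) ∘ ((f ∘ ρ⇒) ∘ ρ⇐)        ≈⟨ ≈.sym toC-∘₁ ⟩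
        (Tη 𝟏 B ∘₁ (f ∘ ρ⇒)) ∘ ρ⇐              ≈⟨ Tᵤ.η-natural 𝟏 (f ∘ ρ⇒) ⟩∘⟨refl ⟩
        (Tmap 𝟏 (f ∘ ρ⇒) ∘₁ Tη 𝟏 A) ∘ ρ⇐       ≈⟨ toC-∘₁ ⟩
        L.map f ∘ (Tη 𝟏 A ∘ ρ⇐)                ∎
    ; μ-natural = λ {A} {B} f → begin
        (Tμ 𝟏 B ∘ ρ⇐) ∘ (Tmap 𝟏 (L.map f ∘ ρ⇒) ∘ ρ⇐)  ≈⟨ refl⟩∘⟨ (Tmap₁-toC-fromC ⟩∘⟨refl) ⟩
        (Tμ 𝟏 B ∘ ρ⇐) ∘ (Tmap 𝟏 (Tmap 𝟏 (f ∘ ρ⇒)) ∘ ρ⇐) ≈⟨ ≈.sym toC-∘₁ ⟩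
        (Tμ 𝟏 B ∘₁ Tmap 𝟏 (Tmap 𝟏 (f ∘ ρ⇒))) ∘ ρ⇐     ≈⟨ Tᵤ.μ-natural 𝟏 (f ∘ ρ⇒) ⟩∘⟨refl ⟩
        (Tmap 𝟏 (f ∘ ρ⇒) ∘₁ Tμ 𝟏 A) ∘ ρ⇐              ≈⟨ toC-∘₁ ⟩
        L.map f ∘ (Tμ 𝟏 A ∘ ρ⇐)                       ∎
    ; μ-assoc = λ A → begin
        (Tμ 𝟏 A ∘ ρ⇐) ∘ (Tmap 𝟏 ((Tμ 𝟏 A ∘ ρ⇐) ∘ ρ⇒) ∘ ρ⇐) ≈⟨ refl⟩∘⟨ (Tmap₁-toC-fromC ⟩∘⟨refl) ⟩
        (Tμ 𝟏 A ∘ ρ⇐) ∘ (Tmap 𝟏 (Tμ 𝟏 A) ∘ ρ⇐)            ≈⟨ ≈.sym toC-∘₁ ⟩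
        (Tμ 𝟏 A ∘₁ Tmap 𝟏 (Tμ 𝟏 A)) ∘ ρ⇐                  ≈⟨ Tᵤ.μ-assoc 𝟏 A ⟩∘⟨refl ⟩
        (Tμ 𝟏 A ∘₁ Tμ 𝟏 (T₀ A)) ∘ ρ⇐                      ≈⟨ toC-∘₁ ⟩
        (Tμ 𝟏 A ∘ ρ⇐) ∘ (Tμ 𝟏 (T₀ A) ∘ ρ⇐)                ∎
    ; μ-unitˡ = λ A → begin
        (Tμ 𝟏 A ∘ ρ⇐) ∘ (Tη 𝟏 (T₀ A) ∘ ρ⇐)  ≈⟨ ≈.sym toC-∘₁ ⟩
        (Tμ 𝟏 A ∘₁ Tη 𝟏 (T₀ A)) ∘ ρ⇐        ≈⟨ Tᵤ.μ-unitˡ 𝟏 A ⟩∘⟨refl ⟩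
        (ρ⇒ ∘ (id ⊗₁ id)) ∘ ρ⇐              ≈⟨ drop₁∘ρ⇐≈id ⟩
        id                                  ∎
    ; μ-unitʳ = λ A → begin
        (Tμ 𝟏 A ∘ ρ⇐) ∘ (Tmap 𝟏 ((Tη 𝟏 A ∘ ρ⇐) ∘ ρ⇒) ∘ ρ⇐) ≈⟨ refl⟩∘⟨ (Tmap₁-toC-fromC ⟩∘⟨refl) ⟩
        (Tμ 𝟏 A ∘ ρ⇐) ∘ (Tmap 𝟏 (Tη 𝟏 A) ∘ ρ⇐)            ≈⟨ ≈.sym toC-∘₁ ⟩
        (Tμ 𝟏 A ∘₁ Tmap 𝟏 (Tη 𝟏 A)) ∘ ρ⇐                  ≈⟨ Tᵤ.μ-unitʳ 𝟏 A ⟩∘⟨refl ⟩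
        (ρ⇒ ∘ (id ⊗₁ id)) ∘ ρ⇐                            ≈⟨ drop₁∘ρ⇐≈id ⟩
        id                                                ∎
    }

  st-unit₁ : ∀ A (p : IsCI C (id {I})) → L.map ρ⇒ ∘ L.st A (ci I id p) ≈ ρ⇒
  st-unit₁ A p = begin
    L.map ρ⇒ ∘ L.st A c           ≈⟨ refl⟩∘⟨ st≈Tmap-id c A ⟩
    L.map ρ⇒ ∘ Tmap c id          ≈⟨ ≈.sym (Tmap≈map∘Tmap-id c ρ⇒) ⟩
    Tmap c ρ⇒                     ≈⟨ Tᵤ.map-resp c (≈.sym (≈.trans (refl⟩∘⟨ ⊗-id) identityʳ)) ⟩
    Tmap c (ρ⇒ ∘ (id ⊗₁ id))      ≈⟨ Tᵤ.map-id c ⟩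
    ρ⇒ ∘ (id ⊗₁ id)               ≈⟨ ≈.trans (refl⟩∘⟨ ⊗-id) identityʳ ⟩
    ρ⇒                            ∎
    where
    c = ci I id p

  st-assoc₁ : ∀ A (c d : CI C) (p : IsCI C (ρ⇒ ∘ (CI.u c ⊗₁ CI.u d))) →
    L.map α⇒ ∘ L.st A (ci (CI.U c ⊗₀ CI.U d) (ρ⇒ ∘ (CI.u c ⊗₁ CI.u d)) p)
      ≈ L.st (A ⊗₀ CI.U c) d ∘ (L.st A c ⊗₁ id) ∘ α⇒
  st-assoc₁ A c d p = begin
    L.map α⇒ ∘ L.st A meet                                       ≈⟨ refl⟩∘⟨ st≈Tmap-id meet A ⟩
    L.map α⇒ ∘ Tmap meet id                                      ≈⟨ ≈.sym (Tmap≈map∘Tmap-id meet α⇒) ⟩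
    Tmap meet α⇒                                                 ≈⟨ Tᵤ.map-resp meet α⇒-projections ⟩
    Tmap meet ((id ⊗₁ πV) ∘ᵤ (id ∘ (id ⊗₁ πU)))                  ≈⟨ Tᵤ.map-comp meet _ _ ⟩
    Tmap meet (id ⊗₁ πV) ∘ᵤ Tmap meet (id ∘ (id ⊗₁ πU))          ≈⟨ Tmap-πV ⟩∘⟨ ((restr-map meet c πU w≈u∘πU id ⟩⊗⟨ ≈.refl) ⟩∘⟨refl) ⟩
    (Tmap d id ∘ (id ⊗₁ πV)) ∘ᵤ (Tmap c id ∘ (id ⊗₁ πU))         ≈⟨ pullʳ (∘ᵤ-projections (Tmap c id)) ⟩
    Tmap d id ∘ (Tmap c id ⊗₁ id) ∘ α⇒                           ≈⟨ ≈.sym (st≈Tmap-id d _) ⟩∘⟨ ((≈.sym (st≈Tmap-id c A) ⟩⊗⟨ ≈.refl) ⟩∘⟨refl) ⟩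
    L.st (A ⊗₀ CI.U c) d ∘ (L.st A c ⊗₁ id) ∘ α⇒                 ∎
    where
    open Meet c d p
    open Idempotent meet using (_∘ᵤ_)
    α⇒-projections : α⇒ ≈ (id ⊗₁ πV) ∘ᵤ (id ∘ (id ⊗₁ πU))
    α⇒-projections = ≈.sym (≈.trans (∘ᵤ-projections id) (≈.trans (⊗-id ⟩∘⟨refl) identityˡ))
    Tmap-πV : Tmap meet (id ⊗₁ πV) ≈ Tmap d id ∘ (id ⊗₁ πV)
    Tmap-πV = ≈.trans (Tᵤ.map-resp meet (≈.sym identityˡ)) (restr-map meet d πV w≈v∘πV id)

  st-η₁ : ∀ A (c : CI C) → L.η (A ⊗₀ CI.U c) ≈ L.st A c ∘ (L.η A ⊗₁ id)
  st-η₁ A c = ≈.sym (begin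
    L.st A c ∘ ((Tη 𝟏 A ∘ ρ⇐) ⊗₁ id)             ≈⟨ st≈Tmap-id c A ⟩∘⟨refl ⟩
    Tmap c id ∘ ((Tη 𝟏 A ∘ ρ⇐) ⊗₁ id)            ≈⟨ ≈.sym ∘ᵤ-factorʳ ⟩
    Tmap c id ∘ᵤ (Tη 𝟏 A ∘ (id ⊗₁ u))            ≈⟨ refl⟩∘⟨ ((≈.sym (restr-η c 𝟏 u (u≤1 c) A) ⟩⊗⟨ ≈.refl) ⟩∘⟨refl) ⟩
    Tmap c id ∘ᵤ Tη c A                          ≈⟨ ≈.sym (Tᵤ.η-natural c id) ⟩
    Tη c (A ⊗₀ U) ∘ᵤ id                          ≈⟨ restr-η c 𝟏 u (u≤1 c) (A ⊗₀ U) ⟩∘⟨refl ⟩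
    (Tη 𝟏 (A ⊗₀ U) ∘ (id ⊗₁ u)) ∘ᵤ id            ≈⟨ ∘ᵤ-factorˡ ⟩
    Tη 𝟏 (A ⊗₀ U) ∘ ρ⇐ ∘ id                      ≈⟨ refl⟩∘⟨ identityʳ ⟩
    Tη 𝟏 (A ⊗₀ U) ∘ ρ⇐                           ∎)
    where
    open Idempotent c

  st-μ₁ : ∀ A (c : CI C) →
    L.μ (A ⊗₀ CI.U c) ∘ L.map (L.st A c) ∘ L.st (T₀ A) c ≈ L.st A c ∘ (L.μ A ⊗₁ id)
  st-μ₁ A c = begin
    (Tμ 𝟏 (A ⊗₀ U) ∘ ρ⇐) ∘ L.map (L.st A c) ∘ L.st (T₀ A) c ≈⟨ refl⟩∘⟨ (refl⟩∘⟨ st≈Tmap-id c (T₀ A)) ⟩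
    (Tμ 𝟏 (A ⊗₀ U) ∘ ρ⇐) ∘ L.map (L.st A c) ∘ Tmap c id     ≈⟨ refl⟩∘⟨ ≈.sym (Tmap≈map∘Tmap-id c (L.st A c)) ⟩
    (Tμ 𝟏 (A ⊗₀ U) ∘ ρ⇐) ∘ Tmap c (L.st A c)                ≈⟨ refl⟩∘⟨ Tᵤ.map-resp c (st≈Tmap-id c A) ⟩
    (Tμ 𝟏 (A ⊗₀ U) ∘ ρ⇐) ∘ Tmap c (Tmap c id)               ≈⟨ ≈.trans assoc (≈.sym ∘ᵤ-factorˡ) ⟩
    (Tμ 𝟏 (A ⊗₀ U) ∘ (id ⊗₁ u)) ∘ᵤ Tmap c (Tmap c id)       ≈⟨ ≈.sym (restr-μ c 𝟏 u (u≤1 c) (A ⊗₀ U)) ⟩∘⟨refl ⟩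
    Tμ c (A ⊗₀ U) ∘ᵤ Tmap c (Tmap c id)                     ≈⟨ Tᵤ.μ-natural c id ⟩
    Tmap c id ∘ᵤ Tμ c A                                     ≈⟨ refl⟩∘⟨ ((restr-μ c 𝟏 u (u≤1 c) A ⟩⊗⟨ ≈.refl) ⟩∘⟨refl) ⟩
    Tmap c id ∘ᵤ (Tμ 𝟏 A ∘ (id ⊗₁ u))                       ≈⟨ ∘ᵤ-factorʳ ⟩
    Tmap c id ∘ ((Tμ 𝟏 A ∘ ρ⇐) ⊗₁ id)                       ≈⟨ ≈.sym (st≈Tmap-id c A) ⟩∘⟨refl ⟩
    L.st A c ∘ ((Tμ 𝟏 A ∘ ρ⇐) ⊗₁ id)                        ∎
    where
    open Idempotent c

  st-m₁ : ∀ A (c d : CI C) (m : CI.U c ⇒ CI.U d) → CI.u c ≈ CI.u d ∘ m →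
    L.st A d ∘ (id ⊗₁ m) ≈ L.map (id ⊗₁ m) ∘ L.st A c
  st-m₁ A c d m u≤v = begin
    L.st A d ∘ (id ⊗₁ m)           ≈⟨ st≈Tmap-id d A ⟩∘⟨refl ⟩
    Tmap d id ∘ (id ⊗₁ m)          ≈⟨ ≈.sym (restr-map c d m u≤v id) ⟩
    Tmap c (id ∘ (id ⊗₁ m))        ≈⟨ Tᵤ.map-resp c identityˡ ⟩
    Tmap c (id ⊗₁ m)               ≈⟨ Tmap≈map∘Tmap-id c _ ⟩
    L.map (id ⊗₁ m) ∘ Tmap c id    ≈⟨ refl⟩∘⟨ ≈.sym (st≈Tmap-id c A) ⟩
    L.map (id ⊗₁ m) ∘ L.st A c     ∎

  st-nat₁ : ∀ {A B} (f : A ⇒ B) (c : CI C) →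
    L.st B c ∘ (L.map f ⊗₁ id) ≈ L.map (f ⊗₁ id) ∘ L.st A c
  st-nat₁ {A} {B} f c = begin
    L.st B c ∘ (L.map f ⊗₁ id)                              ≈⟨ st≈Tmap-id c B ⟩∘⟨refl ⟩
    Tmap c id ∘ ((Tmap 𝟏 (f ∘ ρ⇒) ∘ ρ⇐) ⊗₁ id)              ≈⟨ ≈.sym ∘ᵤ-factorʳ ⟩
    Tmap c id ∘ᵤ (Tmap 𝟏 (f ∘ ρ⇒) ∘ (id ⊗₁ u))              ≈⟨ refl⟩∘⟨ ((≈.sym (restr-map c 𝟏 u (u≤1 c) (f ∘ ρ⇒)) ⟩⊗⟨ ≈.refl) ⟩∘⟨refl) ⟩
    Tmap c id ∘ᵤ Tmap c ((f ∘ ρ⇒) ∘ (id ⊗₁ u))              ≈⟨ ≈.sym (Tᵤ.map-comp c _ _) ⟩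
    Tmap c (id ∘ᵤ ((f ∘ ρ⇒) ∘ (id ⊗₁ u)))                   ≈⟨ Tᵤ.map-resp c (≈.trans ∘ᵤ-factorʳ (≈.trans identityˡ (cancelʳ ρ-isoʳ ⟩⊗⟨ ≈.refl))) ⟩
    Tmap c (f ⊗₁ id)                                        ≈⟨ Tmap≈map∘Tmap-id c _ ⟩
    L.map (f ⊗₁ id) ∘ Tmap c id                             ≈⟨ refl⟩∘⟨ ≈.sym (st≈Tmap-id c A) ⟩
    L.map (f ⊗₁ id) ∘ L.st A c                              ∎
    where
    open Idempotent c

  isLocalisable : IsLocalisable C (Ψ C p₁ F)
  isLocalisable = record
    { isMonad = isMonad₁
    ; st-unit = st-unit₁
    ; st-assoc = st-assoc₁
    ; st-η = st-η₁
    ; st-μ = st-μ₁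
    ; st-m = st-m₁
    ; st-nat = st-nat₁
    }

  ΦΨ≈id : FormalEq C F (Φ C (Ψ C p₁ F))
  ΦΨ≈id = record
    { map≈ = λ c {A} f → ≈.trans (Tmap≈map∘Tmap-id c f) (refl⟩∘⟨ ≈.sym (st≈Tmap-id c A))
    ; η≈ = λ c A → restrict-to-embed c (restr-η c 𝟏 (CI.u c) (u≤1 c) A)
    ; μ≈ = λ c A → restrict-to-embed c (restr-μ c 𝟏 (CI.u c) (u≤1 c) A)
    }
    where
    restrict-to-embed : ∀ (c : CI C) {A B} {x : (A ⊗₀ CI.U c) ⇒ B} {y : (A ⊗₀ I) ⇒ B} →
                        x ≈ y ∘ (id ⊗₁ CI.u c) → x ≈ Idempotent.embed c (y ∘ ρ⇐)
    restrict-to-embed c {x = x} {y} x≈y∘id⊗u = begin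
      x                           ≈⟨ x≈y∘id⊗u ⟩
      y ∘ (id ⊗₁ u)               ≈⟨ refl⟩∘⟨ ≈.sym (cancelˡ ρ-isoˡ) ⟩
      y ∘ ρ⇐ ∘ drop               ≈⟨ sym-assoc ⟩
      (y ∘ ρ⇐) ∘ drop             ≈⟨ ≈.sym embed≈∘drop ⟩
      embed (y ∘ ρ⇐)              ∎
      where
      open Idempotent c

theorem4p6 : ∀ {o ℓ e} (C : SMC o ℓ e) → Stiff C →
    (p₁ : IsCI C (SMC.id C {SMC.I C})) → (T₀ : SMC.Obj C → SMC.Obj C) →
    ((L : LocData C T₀) → IsLocalisable C L → IsFormal C (Φ C L)) ×
    ((F : FormalData C T₀) → IsFormal C F → IsLocalisable C (Ψ C p₁ F)) ×
    ((L : LocData C T₀) → IsLocalisable C L → LocEq C L (Ψ C p₁ (Φ C L))) ×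
    ((F : FormalData C T₀) → IsFormal C F → FormalEq C F (Φ C (Ψ C p₁ F)))
theorem4p6 C _ p₁ T₀ =
  (λ L isL → LocalisableToFormal.isFormal C p₁ L isL) ,
  (λ F isF → FormalToLocalisable.isLocalisable C p₁ F isF) ,
  (λ L isL → LocalisableToFormal.ΨΦ≈id C p₁ L isL) ,
  (λ F isF → FormalToLocalisable.ΦΨ≈id C p₁ F isF)
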